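{- Let $G$ be a simple connected signed graph on $n\geq 2$ vertices $1,\ldots,n$ with net Laplacian matrix $L^{\pm}$, and let $L_{|G|}$ be the Laplacian matrix of the underlying unsigned graph $|G|$. Then for each $i=1,2,\ldots,n$: (a) $\frac{1}{2}\left[\det(L_{|G|}(i))+\det(L^{\pm}(i))\right]$ is the number of positive spanning trees of $G$, and (b) $\frac{1}{2}\left[\det(L_{|G|}(i))-\det(L^{\pm}(i))\right]$ is the number of negative spanning trees of $G$.
   Context: A simple signed graph $G$ consists of a simple graph on vertex set $\{1,\ldots,n\}$ together with a sign $\sigma(e)\in\{1,-1\}$ for each edge $e$ (positive edge if $1$, negative edge if $-1$). The underlying unsigned graph $|G|$ is the graph obtained by forgetting the signs; its Laplacian is $L_{|G|}=D-|A|$ with $D$ the diagonal degree matrix and $|A|$ the $0/1$ adjacency matrix. The adjacency matrix $A$ of $G$ has $(i,j)$-entry $\sigma(\{i,j\})$ if $\{i,j\}$ is an edge and $0$ otherwise. The net degree of a vertex is the number of positive minus the number of negative edges incident with it; $D^{\pm}$ is the diagonal matrix of net degrees and $L^{\pm}=D^{\pm}-A$. For a square matrix $X$, $X(i)$ denotes $X$ with row $i$ and column $i$ deleted. A spanning tree of $G$ is positive if it contains an even number of negative edges and negative otherwise. -}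

module Defs where

open import Data.Nat as ℕ using (ℕ; zero; suc; _%_)
open import Data.Integer as ℤ using (ℤ; +_; -[1+_]; ∣_∣; _-_)
open import Data.Integer.Properties as ℤP using ()
open import Data.Fin as Fin using (Fin; zero; suc; toℕ; punchIn)
open import Data.Fin.Properties as FinP using ()
open import Data.Bool using (Bool; true; false; _∧_; if_then_else_)
open import Data.Vec using (Vec; lookup)
open import Data.List using (List; []; _∷_; _++_; length)
open import Data.List.Relation.Unary.Unique.Propositional using (Unique)
open import Data.List.Relation.Unary.Linked using (Linked)
open import Data.List.Membership.Propositional using (_∈_)
open import Data.Product using (Σ; _×_; ∃)
open import Data.Sum using (_⊎_)
open import Function.Bundles using (_⇔_)
open import Relation.Binary.PropositionalEquality using (_≡_; _≢_)
open import Relation.Nullary.Decidable using (does)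

Matrix : ℕ → Set
Matrix n = Fin n → Fin n → ℤ

sumF : ∀ {n} → (Fin n → ℤ) → ℤ
sumF {zero}  f = + 0
sumF {suc n} f = f zero ℤ.+ sumF (λ j → f (suc j))

signPow : ℕ → ℤ
signPow zero          = + 1
signPow (suc zero)    = -[1+ 0 ]
signPow (suc (suc k)) = signPow k

det : ∀ {n} → Matrix n → ℤ
det {zero}  M = + 1
det {suc n} M =
  sumF (λ j → signPow (toℕ j) ℤ.* M zero j ℤ.* det (λ a b → M (suc a) (punchIn j b)))

principalMinor : ∀ {m} → Fin (suc m) → Matrix (suc m) → Matrix m
principalMinor i X a b = X (punchIn i a) (punchIn i b)

-- Simple signed graphs, given by their signed adjacency matrix A:
-- A i j = +1 (positive edge), -1 (negative edge), 0 (no edge).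

IsSignEntry : ℤ → Set
IsSignEntry x = (x ≡ + 1) ⊎ (x ≡ + 0) ⊎ (x ≡ -[1+ 0 ])

record IsSimpleSignedGraph {n : ℕ} (A : Matrix n) : Set where
  field
    entries   : ∀ i j → IsSignEntry (A i j)
    symmetric : ∀ i j → A i j ≡ A j i
    loopless  : ∀ i → A i i ≡ + 0

Adj : ∀ {n} → Matrix n → Fin n → Fin n → Set
Adj A i j = A i j ≢ + 0

data Walk {n : ℕ} (E : Fin n → Fin n → Set) : Fin n → Fin n → Set where
  here : ∀ {u} → Walk E u u
  step : ∀ {u v w} → E u v → Walk E v w → Walk E u w

Connected : ∀ {n} → (Fin n → Fin n → Set) → Set
Connected {n} E = ∀ (u v : Fin n) → Walk E u v

IsCycle : ∀ {n} → (Fin n → Fin n → Set) → List (Fin n) → Set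
IsCycle E []       = Data.Empty.⊥ where import Data.Empty
IsCycle E (x ∷ xs) =
  Unique (x ∷ xs) × (3 ℕ.≤ length (x ∷ xs)) × Linked E ((x ∷ xs) ++ (x ∷ []))

Acyclic : ∀ {n} → (Fin n → Fin n → Set) → Set
Acyclic {n} E = ∀ (c : List (Fin n)) → IsCycle E c → Data.Empty.⊥ where import Data.Empty

-- Edge subsets: a 0/1 (Bool) n×n table T, entry (i,j) says whether the
-- edge {i,j} is chosen.

EdgeSet : ℕ → Set
EdgeSet n = Vec (Vec Bool n) n

_∋ₑ_,_ : ∀ {n} → EdgeSet n → Fin n → Fin n → Bool
T ∋ₑ i , j = lookup (lookup T i) j

InT : ∀ {n} → EdgeSet n → Fin n → Fin n → Set
InT T i j = (T ∋ₑ i , j) ≡ true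

record IsSpanningTree {n : ℕ} (A : Matrix n) (T : EdgeSet n) : Set where
  field
    symm       : ∀ i j → (T ∋ₑ i , j) ≡ (T ∋ₑ j , i)
    noLoop     : ∀ i → (T ∋ₑ i , i) ≡ false
    edgesOfG   : ∀ i j → InT T i j → Adj A i j
    connected  : Connected (InT T)
    acyclic    : Acyclic (InT T)

-- number of negative edges in T (each unordered edge {i,j} counted once, via i < j)
negEdgeCount : ∀ {n} → Matrix n → EdgeSet n → ℕ
negEdgeCount A T =
  ∣ sumF (λ i → sumF (λ j →
      if (T ∋ₑ i , j) ∧ does (i FinP.<? j) ∧ does (A i j ℤP.≟ -[1+ 0 ])
      then + 1 else + 0)) ∣

IsPositiveTree IsNegativeTree : ∀ {n} → Matrix n → EdgeSet n → Set
IsPositiveTree A T = IsSpanningTree A T × (negEdgeCount A T % 2 ≡ 0)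
IsNegativeTree A T = IsSpanningTree A T × (negEdgeCount A T % 2 ≡ 1)

-- "exactly k objects of type X satisfy P": a duplicate-free list of length k
-- whose members are exactly those satisfying P.
HasCount : {X : Set} → (X → Set) → ℕ → Set
HasCount {X} P k =
  Σ (List X) λ xs → Unique xs × (∀ x → (x ∈ xs) ⇔ P x) × (length xs ≡ k)

absAdj : ∀ {n} → Matrix n → Matrix n
absAdj A i j = + ∣ A i j ∣

lapAbs : ∀ {n} → Matrix n → Matrix n
lapAbs A i j =
  (if does (i FinP.≟ j) then sumF (λ k → absAdj A i k) else + 0) - absAdj A i j

-- L^± = D^± - A   (net degree = Σ_k A i k = #positive - #negative edges at i)
netLap : ∀ {n} → Matrix n → Matrix n
netLap A i j =
  (if does (i FinP.≟ j) then sumF (λ k → A i k) else + 0) - A i j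

-- Row a of the reduced Laplacian L(i) is Σ_k w(a,k) (e_a − e_k), with e_i = 0. By
-- multilinearity det L(i) is a sum, over all ways of letting every vertex a ≠ i choose a
-- vertex k, of the product of the chosen weights times det (I − P), P the matrix of the
-- choice map. If following the choices from every vertex leads to i, then det (I − P) = 1;
-- otherwise the choices contain a cycle and det (I − P) = 0. The choices of the first kind
-- that use only edges of G are exactly the spanning trees, oriented towards i. With the
-- weights |A| each tree contributes 1, with the weights A it contributes (−1)^(number of its
-- negative edges). Hence det L_{|G|}(i) = p + q and det L^±(i) = p − q.

module Submission where

-- Kept apart from the statement's imports, in which _*_ is multiplication on ℕ.
module SignedMatrixTree where

  open import Defs
  open import Algebra.Bundles using (AbelianGroup)
  open import Data.Bool as Bool using (Bool; true; false; if_then_else_; _∧_; _∨_)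
  import Data.Bool.Properties as BoolP
  open import Data.Empty using (⊥; ⊥-elim)
  open import Data.Unit using (⊤; tt)
  open import Data.Fin using (Fin; zero; suc; toℕ; punchIn; punchOut)
  import Data.Fin.Properties as FinP
  open import Data.Integer using (ℤ; +_; -[1+_]; _+_; _*_; -_; _-_; ∣_∣)
  import Data.Integer.Properties as ℤP
  open import Data.Integer.Solver using (module +-*-Solver)
  open import Data.Maybe using (Maybe; just; nothing; _>>=_; fromMaybe; maybe′)
  import Data.Maybe.Properties as MaybeP
  open import Data.Nat as ℕ using (ℕ; zero; suc; _≤_; _<_; z≤n; s≤s; _%_)
  import Data.Nat.Properties as ℕP
  open import Data.Product using (Σ; _×_; _,_; proj₁; proj₂)
  open import Data.List as List using (List; []; _∷_; _++_; _ʳ++_; length; map; filter; allFin; cartesianProductWith)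
  import Data.List.Properties as ListP
  open import Data.List.Membership.Propositional using (_∈_; _∉_)
  import Data.List.Membership.Propositional.Properties as MemP
  open MemP using (∈-++⁺ˡ; ∈-++⁺ʳ; ∈-∃++)
  open import Data.List.Relation.Unary.All as All using (All; []; _∷_)
  open import Data.List.Relation.Unary.All.Properties using (¬Any⇒All¬)
  import Data.List.Relation.Unary.AllPairs as AllPairs
  open import Data.List.Relation.Unary.Any using (here; there)
  open import Data.List.Relation.Unary.Linked using (Linked; []; [-]; _∷_)
  open import Data.List.Relation.Unary.Unique.Propositional using (Unique)
  import Data.List.Relation.Unary.Unique.Propositional.Properties as UniqueP
  open UniqueP using (Unique[x∷xs]⇒x∉xs)
  open import Data.Vec using (Vec; []; _∷_; lookup; tabulate)
  import Data.Vec.Properties as VecP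
  open import Data.Sum using (_⊎_; inj₁; inj₂; [_,_]′; swap)
  open import Function using (_∘_; id; flip)
  open import Relation.Binary.PropositionalEquality
  open import Relation.Binary using (tri<; tri≈; tri>)
  open import Relation.Nullary using (¬_; yes; no; Dec; _×-dec_; ¬?)
  open import Relation.Nullary.Decidable using (does; decidable-stable)
  open import Function.Bundles using (mk⇔)

  open import Algebra.Properties.Semiring.Sum ℤP.+-*-semiring
    using (sum; sum-cong-≗; ∑-distrib-+; ∑-comm; sum-remove; *-distribˡ-sum; sum-replicate-zero)
  open import Algebra.Properties.Group (AbelianGroup.group ℤP.+-0-abelianGroup)
    using (identityʳ-unique)
  open +-*-Solver

  sumF≡sum : ∀ {n} (f : Fin n → ℤ) → sumF f ≡ sum f
  sumF≡sum {zero}  f = refl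
  sumF≡sum {suc n} f = cong (_+_ (f zero)) (sumF≡sum (f ∘ suc))

  sumF-cong : ∀ {n} {f g : Fin n → ℤ} → (∀ j → f j ≡ g j) → sumF f ≡ sumF g
  sumF-cong {f = f} {g} e rewrite sumF≡sum f | sumF≡sum g = sum-cong-≗ e

  sumF-zero : ∀ {n} (f : Fin n → ℤ) → (∀ j → f j ≡ + 0) → sumF f ≡ + 0
  sumF-zero {n} f e rewrite sumF≡sum f = trans (sum-cong-≗ e) (sum-replicate-zero n)

  sumF-distrib-+ : ∀ {n} (f g : Fin n → ℤ) → sumF (λ j → f j + g j) ≡ sumF f + sumF g
  sumF-distrib-+ f g rewrite sumF≡sum (λ j → f j + g j) | sumF≡sum f | sumF≡sum g = ∑-distrib-+ f g

  *-distribˡ-sumF : ∀ {n} (c : ℤ) (f : Fin n → ℤ) → c * sumF f ≡ sumF (λ j → c * f j)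
  *-distribˡ-sumF c f rewrite sumF≡sum f | sumF≡sum (λ j → c * f j) = *-distribˡ-sum c f

  *-distribʳ-sumF : ∀ {n} (c : ℤ) (f : Fin n → ℤ) → sumF f * c ≡ sumF (λ j → f j * c)
  *-distribʳ-sumF c f = trans (ℤP.*-comm (sumF f) c)
    (trans (*-distribˡ-sumF c f) (sumF-cong λ j → ℤP.*-comm c (f j)))

  neg-distrib-sumF : ∀ {n} (f : Fin n → ℤ) → sumF (λ j → - f j) ≡ - sumF f
  neg-distrib-sumF {zero}  f = refl
  neg-distrib-sumF {suc n} f = trans (cong (_+_ (- f zero)) (neg-distrib-sumF (f ∘ suc)))
                                     (sym (ℤP.neg-distrib-+ (f zero) _))

  sumF-comm : ∀ {m n} (f : Fin m → Fin n → ℤ) →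
    sumF (λ i → sumF (λ j → f i j)) ≡ sumF (λ j → sumF (λ i → f i j))
  sumF-comm f rewrite sumF≡sum (λ i → sumF (λ j → f i j)) | sumF≡sum (λ j → sumF (λ i → f i j))
                    = trans (sum-cong-≗ (λ i → sumF≡sum (f i)))
                            (trans (∑-comm f) (sum-cong-≗ (λ j → sym (sumF≡sum (λ i → f i j)))))

  sumF-remove : ∀ {n} (f : Fin (suc n) → ℤ) j → sumF f ≡ f j + sumF (λ k → f (punchIn j k))
  sumF-remove f j rewrite sumF≡sum f | sumF≡sum (λ k → f (punchIn j k)) = sum-remove {i = j} f

  -- Determinants

  sgn : ∀ {n} → Fin n → ℤ
  sgn j = signPow (toℕ j)

  signPow-suc : ∀ k → signPow (suc k) ≡ - signPow k
  signPow-suc zero          = refl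
  signPow-suc (suc zero)    = refl
  signPow-suc (suc (suc k)) = signPow-suc k

  sgn-suc : ∀ {n} (j : Fin n) → sgn (suc j) ≡ - sgn j
  sgn-suc j = signPow-suc (toℕ j)

  minor : ∀ {n} → Matrix (suc n) → Fin (suc n) → Matrix n
  minor M j a b = M (suc a) (punchIn j b)

  det-cong : ∀ {n} {M N : Matrix n} → (∀ a b → M a b ≡ N a b) → det M ≡ det N
  det-cong {zero}  e = refl
  det-cong {suc n} e = sumF-cong λ j →
    cong₂ (λ x y → sgn j * x * y) (e zero j) (det-cong λ a b → e (suc a) (punchIn j b))

  det-row-additive : ∀ {n} (M N P : Matrix n) r →
    (∀ a b → a ≢ r → N a b ≡ M a b) → (∀ a b → a ≢ r → P a b ≡ M a b) →
    (∀ b → M r b ≡ N r b + P r b) → det M ≡ det N + det P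
  det-row-additive {suc n} M N P zero eN eP eM =
    trans (sumF-cong term)
      (sumF-distrib-+ (λ j → sgn j * N zero j * det (minor N j)) (λ j → sgn j * P zero j * det (minor P j)))
    where
      minorMN : ∀ j → det (minor M j) ≡ det (minor N j)
      minorMN j = det-cong λ a b → sym (eN (suc a) (punchIn j b) λ ())
      minorNP : ∀ j → det (minor N j) ≡ det (minor P j)
      minorNP j = det-cong λ a b → trans (eN (suc a) (punchIn j b) λ ()) (sym (eP (suc a) (punchIn j b) λ ()))
      distrib = solve 4 (λ s x y d → s :* (x :+ y) :* d := s :* x :* d :+ s :* y :* d) refl
      term : ∀ j → sgn j * M zero j * det (minor M j)
                 ≡ sgn j * N zero j * det (minor N j) + sgn j * P zero j * det (minor P j)
      term j = begin
        sgn j * M zero j * det (minor M j)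
          ≡⟨ cong₂ (λ x y → sgn j * x * y) (eM j) (minorMN j) ⟩
        sgn j * (N zero j + P zero j) * det (minor N j)
          ≡⟨ distrib (sgn j) (N zero j) (P zero j) (det (minor N j)) ⟩
        sgn j * N zero j * det (minor N j) + sgn j * P zero j * det (minor N j)
          ≡⟨ cong (λ d → sgn j * N zero j * det (minor N j) + sgn j * P zero j * d) (minorNP j) ⟩
        sgn j * N zero j * det (minor N j) + sgn j * P zero j * det (minor P j) ∎
        where open ≡-Reasoning
  det-row-additive {suc n} M N P (suc r) eN eP eM =
    trans (sumF-cong term)
      (sumF-distrib-+ (λ j → sgn j * N zero j * det (minor N j)) (λ j → sgn j * P zero j * det (minor P j)))
    where
      term : ∀ j → sgn j * M zero j * det (minor M j)
                 ≡ sgn j * N zero j * det (minor N j) + sgn j * P zero j * det (minor P j)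
      term j = begin
        sgn j * M zero j * det (minor M j)
          ≡⟨ cong (sgn j * M zero j *_) (det-row-additive (minor M j) (minor N j) (minor P j) r
                (λ a b a≢r → eN (suc a) (punchIn j b) (a≢r ∘ FinP.suc-injective))
                (λ a b a≢r → eP (suc a) (punchIn j b) (a≢r ∘ FinP.suc-injective))
                (λ b → eM (punchIn j b))) ⟩
        sgn j * M zero j * (det (minor N j) + det (minor P j))
          ≡⟨ ℤP.*-distribˡ-+ (sgn j * M zero j) _ _ ⟩
        sgn j * M zero j * det (minor N j) + sgn j * M zero j * det (minor P j)
          ≡⟨ cong₂ _+_ (cong (λ x → sgn j * x * det (minor N j)) (sym (eN zero j λ ())))
                       (cong (λ x → sgn j * x * det (minor P j)) (sym (eP zero j λ ()))) ⟩
        sgn j * N zero j * det (minor N j) + sgn j * P zero j * det (minor P j) ∎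
        where open ≡-Reasoning

  det-zero-row : ∀ {n} (M : Matrix n) r → (∀ b → M r b ≡ + 0) → det M ≡ + 0
  det-zero-row M r z = identityʳ-unique (det M) (det M) (sym (det-row-additive M M M r
    (λ _ _ _ → refl) (λ _ _ _ → refl) (λ b → trans (z b) (cong₂ _+_ (sym (z b)) (sym (z b))))))

  i≡-i⇒i≡0 : ∀ (i : ℤ) → i ≡ - i → i ≡ + 0
  i≡-i⇒i≡0 (+ zero)  _  = refl
  i≡-i⇒i≡0 (+ suc n) ()
  i≡-i⇒i≡0 -[1+ n ]  ()

  -- Deleting columns j and l of a matrix, in either order.
  punchIn-punchOut-swap : ∀ {n} (j l : Fin (suc (suc n))) (j≢l : j ≢ l) (l≢j : l ≢ j) (b : Fin n) →
    punchIn j (punchIn (punchOut j≢l) b) ≡ punchIn l (punchIn (punchOut l≢j) b)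
  punchIn-punchOut-swap zero    zero    j≢l _ b = ⊥-elim (j≢l refl)
  punchIn-punchOut-swap zero    (suc l) _   _ b = refl
  punchIn-punchOut-swap (suc j) zero    _   _ b = refl
  punchIn-punchOut-swap {suc n} (suc j) (suc l) _ _ zero = refl
  punchIn-punchOut-swap {suc n} (suc j) (suc l) j≢l l≢j (suc b) =
    cong suc (punchIn-punchOut-swap j l (j≢l ∘ cong suc) (l≢j ∘ cong suc) b)

  -- The two orders of expansion carry opposite signs.
  sgn-punchOut-swap : ∀ {n} (j l : Fin (suc (suc n))) (j≢l : j ≢ l) (l≢j : l ≢ j) →
    sgn j * sgn (punchOut j≢l) ≡ - (sgn l * sgn (punchOut l≢j))
  sgn-punchOut-swap zero zero j≢l _ = ⊥-elim (j≢l refl)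
  sgn-punchOut-swap zero (suc l) _ _ rewrite sgn-suc l =
    solve 1 (λ x → con (+ 1) :* x := :- ((:- x) :* con (+ 1))) refl (sgn l)
  sgn-punchOut-swap (suc j) zero _ _ rewrite sgn-suc j =
    solve 1 (λ x → (:- x) :* con (+ 1) := :- (con (+ 1) :* x)) refl (sgn j)
  sgn-punchOut-swap {zero} (suc zero) (suc zero) j≢l _ = ⊥-elim (j≢l refl)
  sgn-punchOut-swap {suc n} (suc j) (suc l) j≢l l≢j
    rewrite sgn-suc j | sgn-suc l | sgn-suc (punchOut {i = j} {j = l} (j≢l ∘ cong suc))
          | sgn-suc (punchOut {i = l} {j = j} (l≢j ∘ cong suc)) =
    trans (negneg (sgn j) (sgn (punchOut {i = j} {j = l} (j≢l ∘ cong suc))))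
      (trans (sgn-punchOut-swap j l (j≢l ∘ cong suc) (l≢j ∘ cong suc))
        (sym (cong -_ (negneg (sgn l) (sgn (punchOut {i = l} {j = j} (l≢j ∘ cong suc)))))))
    where negneg = solve 2 (λ x y → (:- x) :* (:- y) := x :* y) refl

  -- Expanding along row 0 and then row 1 writes det M as a double sum over the columns j ≠ l
  -- used by those rows; when the two rows are equal, the summand is antisymmetric in (j, l).
  module EqualFirstRows {n : ℕ} (M : Matrix (suc (suc n)))
                        (row₀≡row₁ : ∀ b → M zero b ≡ M (suc zero) b) where

    term : Fin (suc (suc n)) → Fin (suc (suc n)) → Fin (suc n) → ℤ
    term j l p = sgn j * sgn p * (M zero j * M zero l)
               * det (λ a b → M (suc (suc a)) (punchIn j (punchIn p b)))

    pairTerm : Fin (suc (suc n)) → Fin (suc (suc n)) → ℤ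
    pairTerm j l with j FinP.≟ l
    ... | yes _   = + 0
    ... | no j≢l = term j l (punchOut j≢l)

    pairTerm-≢ : ∀ j l (j≢l : j ≢ l) → pairTerm j l ≡ term j l (punchOut j≢l)
    pairTerm-≢ j l j≢l with j FinP.≟ l
    ... | yes j≡l = ⊥-elim (j≢l j≡l)
    ... | no _    = cong (term j l) (FinP.punchOut-cong j refl)

    pairTerm-diag : ∀ j → pairTerm j j ≡ + 0
    pairTerm-diag j with j FinP.≟ j
    ... | yes _  = refl
    ... | no j≢j = ⊥-elim (j≢j refl)

    pairTerm-antisym : ∀ j l → pairTerm j l ≡ - pairTerm l j
    pairTerm-antisym j l = byCases (j FinP.≟ l)
      where
        byCases : Dec (j ≡ l) → pairTerm j l ≡ - pairTerm l j
        byCases (yes refl) = trans (pairTerm-diag j) (sym (cong -_ (pairTerm-diag j)))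
        byCases (no j≢l) = trans (pairTerm-≢ j l j≢l) (trans flip-term (cong -_ (sym (pairTerm-≢ l j (j≢l ∘ sym)))))
          where
            sameMinor : det (λ a b → M (suc (suc a)) (punchIn j (punchIn (punchOut j≢l) b)))
                      ≡ det (λ a b → M (suc (suc a)) (punchIn l (punchIn (punchOut (j≢l ∘ sym)) b)))
            sameMinor = det-cong λ a b → cong (M (suc (suc a))) (punchIn-punchOut-swap j l j≢l (j≢l ∘ sym) b)
            flip-term : term j l (punchOut j≢l) ≡ - term l j (punchOut (j≢l ∘ sym))
            flip-term rewrite sameMinor | sgn-punchOut-swap j l j≢l (j≢l ∘ sym) =
              solve 4 (λ x a b d → (:- x) :* (a :* b) :* d := :- (x :* (b :* a) :* d)) refl
                (sgn l * sgn (punchOut (j≢l ∘ sym))) (M zero j) (M zero l) _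

    expand-row₀ : ∀ j → sgn j * M zero j * det (minor M j) ≡ sumF (pairTerm j)
    expand-row₀ j = begin
      sgn j * M zero j * det (minor M j)
        ≡⟨ *-distribˡ-sumF (sgn j * M zero j) (λ k → sgn k * M (suc zero) (punchIn j k) * det (minor (minor M j) k)) ⟩
      sumF (λ k → sgn j * M zero j * (sgn k * M (suc zero) (punchIn j k) * det (minor (minor M j) k)))
        ≡⟨ sumF-cong (λ k → trans
             (cong (λ x → sgn j * M zero j * (sgn k * x * det (minor (minor M j) k))) (sym (row₀≡row₁ (punchIn j k))))
             (regroup (sgn j) (M zero j) (sgn k) (M zero (punchIn j k)) (det (minor (minor M j) k)))) ⟩
      sumF (λ k → term j (punchIn j k) k)
        ≡⟨ sumF-cong (λ k → trans (cong (term j (punchIn j k)) (sym (FinP.punchOut-punchIn j)))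
                                  (sym (pairTerm-≢ j (punchIn j k) (FinP.punchInᵢ≢i j k ∘ sym)))) ⟩
      sumF (λ k → pairTerm j (punchIn j k))
        ≡⟨ sym (trans (sumF-remove (pairTerm j) j)
                      (trans (cong (_+ sumF (λ k → pairTerm j (punchIn j k))) (pairTerm-diag j)) (ℤP.+-identityˡ _))) ⟩
      sumF (pairTerm j) ∎
      where
        open ≡-Reasoning
        regroup = solve 5 (λ a b c d e → a :* b :* (c :* d :* e) := a :* c :* (b :* d) :* e) refl

    doubleSum-antisym : sumF (λ j → sumF (pairTerm j)) ≡ - sumF (λ j → sumF (pairTerm j))
    doubleSum-antisym =
      trans (sumF-comm pairTerm)
        (trans (sumF-cong (λ l → trans (sumF-cong (λ j → pairTerm-antisym j l)) (neg-distrib-sumF (pairTerm l))))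
               (neg-distrib-sumF (λ l → sumF (pairTerm l))))

    det≡0 : det M ≡ + 0
    det≡0 = trans (sumF-cong expand-row₀) (i≡-i⇒i≡0 _ doubleSum-antisym)

  Alternating : ℕ → Set
  Alternating n = ∀ (M : Matrix n) r s → r ≢ s → (∀ b → M r b ≡ M s b) → det M ≡ + 0

  replaceRows : ∀ {n} → Matrix n → Fin n → Fin n → (Fin n → ℤ) → (Fin n → ℤ) → Matrix n
  replaceRows M r s u v a b =
    if does (a FinP.≟ r) then u b else (if does (a FinP.≟ s) then v b else M a b)

  module _ {n} (M : Matrix n) (r s : Fin n) where

    replaceRows-r : ∀ u v b → replaceRows M r s u v r b ≡ u b
    replaceRows-r u v b with r FinP.≟ r
    ... | yes _  = refl
    ... | no r≢r = ⊥-elim (r≢r refl)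

    replaceRows-s : ∀ u v b → r ≢ s → replaceRows M r s u v s b ≡ v b
    replaceRows-s u v b r≢s with s FinP.≟ r | s FinP.≟ s
    ... | yes s≡r | _      = ⊥-elim (r≢s (sym s≡r))
    ... | no _    | yes _  = refl
    ... | no _    | no s≢s = ⊥-elim (s≢s refl)

    replaceRows-matches : ∀ u v (N : Matrix n) → (∀ b → N r b ≡ u b) → (∀ b → N s b ≡ v b) →
      (∀ a b → a ≢ r → a ≢ s → N a b ≡ M a b) → ∀ a b → replaceRows M r s u v a b ≡ N a b
    replaceRows-matches u v N Nr Ns Nother a b with a FinP.≟ r | a FinP.≟ s
    ... | yes refl | _        = sym (Nr b)
    ... | no _     | yes refl = sym (Ns b)
    ... | no a≢r   | no a≢s   = sym (Nother a b a≢r a≢s)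

    replaceRows-≢r : ∀ u u′ v a b → a ≢ r → replaceRows M r s u v a b ≡ replaceRows M r s u′ v a b
    replaceRows-≢r u u′ v a b a≢r with a FinP.≟ r
    ... | yes a≡r = ⊥-elim (a≢r a≡r)
    ... | no _    = refl

    replaceRows-≢s : ∀ u v v′ a b → a ≢ s → replaceRows M r s u v a b ≡ replaceRows M r s u v′ a b
    replaceRows-≢s u v v′ a b a≢s with a FinP.≟ r | a FinP.≟ s
    ... | yes _ | _       = refl
    ... | no _  | yes a≡s = ⊥-elim (a≢s a≡s)
    ... | no _  | no _    = refl

    det-replaceRows-additive : ∀ u v w → r ≢ s →
      det (replaceRows M r s u (λ b → v b + w b)) ≡ det (replaceRows M r s u v) + det (replaceRows M r s u w)
    det-replaceRows-additive u v w r≢s =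
      det-row-additive (replaceRows M r s u v+w) (replaceRows M r s u v) (replaceRows M r s u w) s
        (λ a b a≢s → replaceRows-≢s u v v+w a b a≢s) (λ a b a≢s → replaceRows-≢s u w v+w a b a≢s)
        (λ b → trans (replaceRows-s u v+w b r≢s) (sym (cong₂ _+_ (replaceRows-s u v b r≢s) (replaceRows-s u w b r≢s))))
      where
        v+w : Fin n → ℤ
        v+w b = v b + w b

  -- In the presence of alternation, exchanging two rows negates the determinant: expand
  -- 0 = det(X+Y; X+Y) = det(X; X) + det(X; Y) + det(Y; X) + det(Y; Y) by additivity.
  det-swap-rows : ∀ {n} → Alternating n → ∀ (M N : Matrix n) r s → r ≢ s →
    (∀ b → N r b ≡ M s b) → (∀ b → N s b ≡ M r b) → (∀ a b → a ≢ r → a ≢ s → N a b ≡ M a b) →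
    det N ≡ - det M
  det-swap-rows alt M N r s r≢s Nr Ns Nother = begin
    det N                                     ≡⟨ cancel (det M) (det N) ⟨
    - det M + (det M + det N)                 ≡⟨ cong (λ z → - det M + z) (cong₂ _+_ XY≡M YX≡N) ⟨
    - det M + (det (rows X Y) + det (rows Y X)) ≡⟨ cong (λ z → - det M + z) (cong₂ _+_ (X-split) (Y-split)) ⟨
    - det M + (det (rows X (X ⊕ Y)) + det (rows Y (X ⊕ Y)))
        ≡⟨ cong (λ z → - det M + z) sum-split ⟨
    - det M + det (rows (X ⊕ Y) (X ⊕ Y))      ≡⟨ cong (λ z → - det M + z) (equal (X ⊕ Y)) ⟩
    - det M + + 0                             ≡⟨ ℤP.+-identityʳ (- det M) ⟩
    - det M                                   ∎
    where
      open ≡-Reasoning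
      X = M r
      Y = M s
      _⊕_ : (Fin _ → ℤ) → (Fin _ → ℤ) → Fin _ → ℤ
      (u ⊕ v) b = u b + v b
      rows = replaceRows M r s
      cancel = solve 2 (λ m n → :- m :+ (m :+ n) := n) refl
      equal : ∀ u → det (rows u u) ≡ + 0
      equal u = alt (rows u u) r s r≢s λ b → trans (replaceRows-r M r s u u b) (sym (replaceRows-s M r s u u b r≢s))
      sum-split : det (rows (X ⊕ Y) (X ⊕ Y)) ≡ det (rows X (X ⊕ Y)) + det (rows Y (X ⊕ Y))
      sum-split = det-row-additive (rows (X ⊕ Y) (X ⊕ Y)) (rows X (X ⊕ Y)) (rows Y (X ⊕ Y)) r
        (λ a b a≢r → replaceRows-≢r M r s X (X ⊕ Y) (X ⊕ Y) a b a≢r)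
        (λ a b a≢r → replaceRows-≢r M r s Y (X ⊕ Y) (X ⊕ Y) a b a≢r)
        (λ b → trans (replaceRows-r M r s (X ⊕ Y) (X ⊕ Y) b)
                     (sym (cong₂ _+_ (replaceRows-r M r s X (X ⊕ Y) b) (replaceRows-r M r s Y (X ⊕ Y) b))))
      X-split : det (rows X (X ⊕ Y)) ≡ det (rows X Y)
      X-split = trans (det-replaceRows-additive M r s X X Y r≢s)
                      (trans (cong (_+ det (rows X Y)) (equal X)) (ℤP.+-identityˡ _))
      Y-split : det (rows Y (X ⊕ Y)) ≡ det (rows Y X)
      Y-split = trans (det-replaceRows-additive M r s Y X Y r≢s)
                      (trans (cong (_+_ (det (rows Y X))) (equal Y)) (ℤP.+-identityʳ _))
      XY≡M : det (rows X Y) ≡ det M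
      XY≡M = det-cong (replaceRows-matches M r s X Y M (λ _ → refl) (λ _ → refl) (λ _ _ _ _ → refl))
      YX≡N : det (rows Y X) ≡ det N
      YX≡N = det-cong (replaceRows-matches M r s Y X N Nr Ns Nother)

  -- Row 0 equal to row s+1: exchanging rows 1 and s+1 (rows 0 and s of every minor)
  -- negates det M and reduces to EqualFirstRows.
  det-equal-row₀ : ∀ {n} → Alternating n → (M : Matrix (suc n)) (s : Fin n) →
    (∀ b → M zero b ≡ M (suc s) b) → det M ≡ + 0
  det-equal-row₀ {suc n} alt M zero    eq = EqualFirstRows.det≡0 M eq
  det-equal-row₀ {suc n} alt M (suc s) eq =
    trans (sym (ℤP.neg-involutive (det M))) (cong -_ (trans (sym det-M′) (EqualFirstRows.det≡0 M′ eq)))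
    where
      M′ : Matrix (suc (suc n))
      M′ zero          b = M zero b
      M′ (suc zero)    b = M (suc (suc s)) b
      M′ (suc (suc a)) b = if does (a FinP.≟ s) then M (suc zero) b else M (suc (suc a)) b
      row-s : ∀ b → M′ (suc (suc s)) b ≡ M (suc zero) b
      row-s b with s FinP.≟ s
      ... | yes _  = refl
      ... | no s≢s = ⊥-elim (s≢s refl)
      row-other : ∀ a b → a ≢ s → M′ (suc (suc a)) b ≡ M (suc (suc a)) b
      row-other a b a≢s with a FinP.≟ s
      ... | yes a≡s = ⊥-elim (a≢s a≡s)
      ... | no _    = refl
      minor-swapped : ∀ j → det (minor M′ j) ≡ - det (minor M j)
      minor-swapped j = det-swap-rows alt (minor M j) (minor M′ j) zero (suc s) (λ ())
        (λ b → refl) (λ b → row-s (punchIn j b))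
        (λ { zero b 0≢0 _ → ⊥-elim (0≢0 refl) ; (suc a) b _ a≢s → row-other a (punchIn j b) (a≢s ∘ cong suc) })
      det-M′ : det M′ ≡ - det M
      det-M′ = trans (sumF-cong λ j → trans (cong (sgn j * M zero j *_) (minor-swapped j))
                                            (sym (ℤP.neg-distribʳ-* (sgn j * M zero j) (det (minor M j)))))
                     (neg-distrib-sumF (λ j → sgn j * M zero j * det (minor M j)))

  det-alternating : ∀ {n} → Alternating n
  det-alternating {suc n} M zero    zero    0≢0 _  = ⊥-elim (0≢0 refl)
  det-alternating {suc n} M zero    (suc s) _   eq = det-equal-row₀ det-alternating M s eq
  det-alternating {suc n} M (suc r) zero    _   eq = det-equal-row₀ det-alternating M r (sym ∘ eq)
  det-alternating {suc n} M (suc r) (suc s) r≢s eq = sumF-zero _ λ j →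
    trans (cong (sgn j * M zero j *_) (det-alternating (minor M j) r s (r≢s ∘ cong suc) (λ b → eq (punchIn j b))))
          (ℤP.*-zeroʳ (sgn j * M zero j))

  det-add-row : ∀ {n} (M N : Matrix n) r s → r ≢ s →
    (∀ a b → a ≢ r → N a b ≡ M a b) → (∀ b → N r b ≡ M r b + M s b) → det N ≡ det M
  det-add-row M N r s r≢s Nother Nr = begin
    det N         ≡⟨ det-row-additive N M Q r (λ a b a≢r → sym (Nother a b a≢r))
                       (λ a b a≢r → trans (Q-other a b a≢r) (sym (Nother a b a≢r)))
                       (λ b → trans (Nr b) (cong (_+_ (M r b)) (sym (Q-r b)))) ⟩
    det M + det Q ≡⟨ cong (_+_ (det M)) (det-alternating Q r s r≢s λ b → trans (Q-r b) (sym (Q-other s b (r≢s ∘ sym)))) ⟩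
    det M + + 0   ≡⟨ ℤP.+-identityʳ (det M) ⟩
    det M         ∎
    where
      open ≡-Reasoning
      Q : Matrix _
      Q a b = if does (a FinP.≟ r) then M s b else M a b
      Q-r : ∀ b → Q r b ≡ M s b
      Q-r b with r FinP.≟ r
      ... | yes _  = refl
      ... | no r≢r = ⊥-elim (r≢r refl)
      Q-other : ∀ a b → a ≢ r → Q a b ≡ M a b
      Q-other a b a≢r with a FinP.≟ r
      ... | yes a≡r = ⊥-elim (a≢r a≡r)
      ... | no _    = refl

  -- Partial self-maps and their graph matrices

  δ : ∀ {m} → Fin m → Fin m → ℤ
  δ a b = if does (a FinP.≟ b) then + 1 else + 0

  δ-suc : ∀ {m} (a b : Fin m) → δ (suc a) (suc b) ≡ δ a b
  δ-suc a b with a FinP.≟ b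
  ... | yes refl = refl
  ... | no _     = refl

  δ-≢ : ∀ {m} (a b : Fin m) → a ≢ b → δ a b ≡ + 0
  δ-≢ a b a≢b with a FinP.≟ b
  ... | yes a≡b = ⊥-elim (a≢b a≡b)
  ... | no _    = refl

  δ-refl : ∀ {m} (a : Fin m) → δ a a ≡ + 1
  δ-refl a with a FinP.≟ a
  ... | yes _  = refl
  ... | no a≢a = ⊥-elim (a≢a refl)

  pointsTo : ∀ {m} → Maybe (Fin m) → Fin m → ℤ
  pointsTo nothing  b = + 0
  pointsTo (just c) b = δ c b

  -- I − P_h, where P_h is the 0/1 matrix of h; h a ≡ nothing means that a points outside
  -- (in the application, to the deleted root), and then row a of P_h is zero.
  graphMatrix : ∀ {m} → (Fin m → Maybe (Fin m)) → Matrix m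
  graphMatrix h a b = δ a b - pointsTo (h a) b

  iterate : ∀ {m} → (Fin m → Maybe (Fin m)) → ℕ → Fin m → Maybe (Fin m)
  iterate h zero    a = just a
  iterate h (suc k) a = iterate h k a >>= h

  >>=-identityʳ : ∀ {A : Set} (x : Maybe A) → (x >>= just) ≡ x
  >>=-identityʳ nothing  = refl
  >>=-identityʳ (just x) = refl

  >>=-assoc : ∀ {A B C : Set} (x : Maybe A) (f : A → Maybe B) (g : B → Maybe C) →
    ((x >>= f) >>= g) ≡ (x >>= λ y → f y >>= g)
  >>=-assoc nothing  f g = refl
  >>=-assoc (just x) f g = refl

  module _ {m} (h : Fin m → Maybe (Fin m)) where

    iterate-+ : ∀ k l a → iterate h (k ℕ.+ l) a ≡ (iterate h k a >>= iterate h l)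
    iterate-+ k zero    a rewrite ℕP.+-identityʳ k = sym (>>=-identityʳ (iterate h k a))
    iterate-+ k (suc l) a rewrite ℕP.+-suc k l =
      trans (cong (_>>= h) (iterate-+ k l a)) (>>=-assoc (iterate h k a) (iterate h l) h)

    iterate-nothing : ∀ k l a → iterate h k a ≡ nothing → iterate h (k ℕ.+ l) a ≡ nothing
    iterate-nothing k l a e = trans (iterate-+ k l a) (cong (_>>= iterate h l) e)

    iterate-periodic : ∀ u x → iterate h u x ≡ just x → ∀ j → iterate h (j ℕ.* u) x ≡ just x
    iterate-periodic u x e zero    = refl
    iterate-periodic u x e (suc j) =
      trans (iterate-+ u (j ℕ.* u) x) (trans (cong (_>>= iterate h (j ℕ.* u)) e) (iterate-periodic u x e j))

    periodic⇒iterate-just : ∀ u x → 1 ≤ u → iterate h u x ≡ just x → ∀ k → iterate h k x ≢ nothing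
    periodic⇒iterate-just (suc u) x _ e k ek = just≢nothing
      (trans (sym (iterate-periodic (suc u) x e k))
             (trans (sym (cong (λ t → iterate h t x) k+[ku∸k]≡ku)) (iterate-nothing k _ x ek)))
      where
        just≢nothing : just x ≢ nothing
        just≢nothing ()
        k+[ku∸k]≡ku : k ℕ.+ (k ℕ.* suc u ℕ.∸ k) ≡ k ℕ.* suc u
        k+[ku∸k]≡ku = ℕP.m+[n∸m]≡n (ℕP.m≤m*n k (suc u))

    reaches-periodic⇒iterate-just : ∀ i u a x → 1 ≤ u → iterate h i a ≡ just x → iterate h u x ≡ just x →
      ∀ k → iterate h k a ≢ nothing
    reaches-periodic⇒iterate-just i u a x 1≤u ei eu k ek = periodic⇒iterate-just u x 1≤u eu k
      (trans (sym (cong (_>>= iterate h k) ei))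
        (trans (sym (iterate-+ i k a)) (trans (cong (λ t → iterate h t a) (ℕP.+-comm i k)) (iterate-nothing k i a ek))))

  least : (P : ℕ → Set) → (∀ k → Dec (P k)) → ∀ k → P k →
    Σ ℕ λ K → K ≤ k × P K × (∀ j → j < K → ¬ P j)
  least P P? k p = [ id , (λ none → ⊥-elim (none k ℕP.≤-refl p)) ]′ (search k)
    where
      search : ∀ k → (Σ ℕ λ K → K ≤ k × P K × (∀ j → j < K → ¬ P j)) ⊎ (∀ j → j ≤ k → ¬ P j)
      search zero with P? zero
      ... | yes p0 = inj₁ (zero , z≤n , p0 , λ j ())
      ... | no ¬p0 = inj₂ λ { zero _ → ¬p0 }
      search (suc k) with search k
      ... | inj₁ (K , K≤k , pK , below) = inj₁ (K , ℕP.m≤n⇒m≤1+n K≤k , pK , below)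
      ... | inj₂ none with P? (suc k)
      ...   | yes p = inj₁ (suc k , ℕP.≤-refl , p , λ j j<1+k → none j (ℕP.≤-pred j<1+k))
      ...   | no ¬p = inj₂ λ j j≤1+k → [ none j ∘ ℕP.≤-pred , (λ { refl → ¬p }) ]′ (ℕP.m≤n⇒m<n∨m≡n j≤1+k)

  ≟nothing : ∀ {A : Set} (x : Maybe A) → Dec (x ≡ nothing)
  ≟nothing nothing  = yes refl
  ≟nothing (just x) = no λ ()

  -- Row x of graphMatrix h, e_x − e_{h x}, turned into e_x − e_{h^(t+1) x} by adding rows along the orbit.
  orbitRowMatrix : ∀ {m} → (Fin m → Maybe (Fin m)) → Fin m → ℕ → Matrix m
  orbitRowMatrix h x t a b =
    if does (a FinP.≟ x) then δ x b - pointsTo (iterate h (suc t) x) b else graphMatrix h a b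

  module _ {m} (h : Fin m → Maybe (Fin m)) (x : Fin m) where

    orbitRowMatrix-x : ∀ t b → orbitRowMatrix h x t x b ≡ δ x b - pointsTo (iterate h (suc t) x) b
    orbitRowMatrix-x t b with x FinP.≟ x
    ... | yes _  = refl
    ... | no x≢x = ⊥-elim (x≢x refl)

    orbitRowMatrix-other : ∀ t a b → a ≢ x → orbitRowMatrix h x t a b ≡ graphMatrix h a b
    orbitRowMatrix-other t a b a≢x with a FinP.≟ x
    ... | yes a≡x = ⊥-elim (a≢x a≡x)
    ... | no _    = refl

    OrbitAvoids : ℕ → Set
    OrbitAvoids t = ∀ u → 1 ≤ u → u ≤ t → Σ (Fin m) λ y → iterate h u x ≡ just y × y ≢ x

    det-orbitRowMatrix : ∀ t → OrbitAvoids t → det (orbitRowMatrix h x t) ≡ det (graphMatrix h)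
    det-orbitRowMatrix zero _ = det-cong entry
      where
        entry : ∀ a b → orbitRowMatrix h x zero a b ≡ graphMatrix h a b
        entry a b with a FinP.≟ x
        ... | yes refl = refl
        ... | no _     = refl
    det-orbitRowMatrix (suc t) avoids with avoids (suc t) (s≤s z≤n) ℕP.≤-refl
    ... | (y , ey , y≢x) = trans
      (det-add-row (orbitRowMatrix h x t) (orbitRowMatrix h x (suc t)) x y (y≢x ∘ sym)
        (λ a b a≢x → trans (orbitRowMatrix-other (suc t) a b a≢x) (sym (orbitRowMatrix-other t a b a≢x)))
        row-x)
      (det-orbitRowMatrix t (λ u 1≤u u≤t → avoids u 1≤u (ℕP.m≤n⇒m≤1+n u≤t)))
      where
        telescope = solve 3 (λ a c d → a :- c :+ (c :- d) := a :- d) refl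
        row-x : ∀ b → orbitRowMatrix h x (suc t) x b ≡ orbitRowMatrix h x t x b + orbitRowMatrix h x t y b
        row-x b = begin
          orbitRowMatrix h x (suc t) x b
            ≡⟨ orbitRowMatrix-x (suc t) b ⟩
          δ x b - pointsTo (iterate h (suc t) x >>= h) b
            ≡⟨ cong (λ z → δ x b - pointsTo (z >>= h) b) ey ⟩
          δ x b - pointsTo (h y) b
            ≡⟨ telescope (δ x b) (δ y b) (pointsTo (h y) b) ⟨
          (δ x b - δ y b) + graphMatrix h y b
            ≡⟨ cong₂ _+_ (trans (orbitRowMatrix-x t b) (cong (λ z → δ x b - pointsTo z b) ey))
                         (orbitRowMatrix-other t y b y≢x) ⟨
          orbitRowMatrix h x t x b + orbitRowMatrix h x t y b ∎
          where open ≡-Reasoning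

    -- Along a cycle the row of x becomes e_x − e_x = 0.
    det-graphMatrix-cycle : ∀ d → iterate h (suc d) x ≡ just x → OrbitAvoids d → det (graphMatrix h) ≡ + 0
    det-graphMatrix-cycle d e avoids = trans (sym (det-orbitRowMatrix d avoids)) (det-zero-row _ x λ b →
      trans (orbitRowMatrix-x d b) (trans (cong (λ z → δ x b - pointsTo z b) e) (ℤP.+-inverseʳ (δ x b))))

    det-graphMatrix-periodic : ∀ u → 1 ≤ u → iterate h u x ≡ just x → det (graphMatrix h) ≡ + 0
    det-graphMatrix-periodic (suc u) 1≤u e
      with least (λ d → iterate h (suc d) x ≡ just x) (λ d → MaybeP.≡-dec FinP._≟_ (iterate h (suc d) x) (just x)) u e
    ... | (d , _ , ed , minimal) = det-graphMatrix-cycle d ed avoids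
      where
        avoids : OrbitAvoids d
        avoids (suc v) _ v<d with iterate h (suc v) x in eq
        ... | nothing = ⊥-elim (periodic⇒iterate-just h (suc u) x (s≤s z≤n) e (suc v) eq)
        ... | just y  = y , refl , λ { refl → minimal v v<d eq }

  Halting : ∀ {m} → (Fin m → Maybe (Fin m)) → Set
  Halting h = ∀ a → Σ ℕ λ k → iterate h k a ≡ nothing

  -- Decidable form of Halting; by pigeonhole m steps suffice (halting⇒haltingWithin).
  HaltingWithin : ∀ {m} → (Fin m → Maybe (Fin m)) → Set
  HaltingWithin {m} h = ∀ a → iterate h m a ≡ nothing

  haltingWithin? : ∀ {m} (h : Fin m → Maybe (Fin m)) → Dec (HaltingWithin h)
  haltingWithin? {m} h = FinP.all? (λ a → ≟nothing (iterate h m a))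

  haltingWithin⇒halting : ∀ {m} (h : Fin m → Maybe (Fin m)) → HaltingWithin h → Halting h
  haltingWithin⇒halting {m} h halts a = m , halts a

  decreasing⇒halting : ∀ {m} (h : Fin m → Maybe (Fin m)) (μ : Fin m → ℕ) →
    (∀ {x y} → h x ≡ just y → μ y < μ x) → Halting h
  decreasing⇒halting h μ decreasing x = suc (μ x) , go (suc (μ x)) x ℕP.≤-refl
    where
      go : ∀ k x → μ x < k → iterate h k x ≡ nothing
      go (suc k) x μx<k with h x in eq
      ... | nothing = trans (iterate-+ h 1 k x) (cong (_>>= iterate h k) eq)
      ... | just y  = trans (iterate-+ h 1 k x)
                        (trans (cong (_>>= iterate h k) eq) (go k y (ℕP.<-≤-trans (decreasing eq) (ℕP.≤-pred μx<k))))

  unsuc : ∀ {m} → Fin (suc m) → Maybe (Fin m)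
  unsuc zero    = nothing
  unsuc (suc b) = just b

  -- Delete vertex 0, treating arrows into it as leaving.
  contract : ∀ {m} → (Fin (suc m) → Maybe (Fin (suc m))) → Fin m → Maybe (Fin m)
  contract h a = h (suc a) >>= unsuc

  iterate-contract : ∀ {m} (h : Fin (suc m) → Maybe (Fin (suc m))) k a →
    (iterate (contract h) k a ≡ nothing) ⊎ (Σ (Fin m) λ c → iterate (contract h) k a ≡ just c × iterate h k (suc a) ≡ just (suc c))
  iterate-contract h zero    a = inj₂ (a , refl , refl)
  iterate-contract h (suc k) a with iterate-contract h k a
  ... | inj₁ e = inj₁ (cong (_>>= contract h) e)
  ... | inj₂ (c , e₁ , e₂) rewrite e₁ | e₂ with h (suc c)
  ...   | nothing       = inj₁ refl
  ...   | just zero     = inj₁ refl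
  ...   | just (suc c′) = inj₂ (c′ , refl , refl)

  halting-contract : ∀ {m} (h : Fin (suc m) → Maybe (Fin (suc m))) → Halting h → Halting (contract h)
  halting-contract h halts a with halts (suc a)
  ... | (k , e) with iterate-contract h k a
  ...   | inj₁ e′ = k , e′
  ...   | inj₂ (_ , _ , e₂) with trans (sym e₂) e
  ...     | ()

  det-unit-row₀ : ∀ {n} (M : Matrix (suc n)) → (∀ b → M zero b ≡ δ zero b) → det M ≡ det (minor M zero)
  det-unit-row₀ {n} M e = begin
    + 1 * M zero zero * det (minor M zero) + sumF (λ j → sgn (suc j) * M zero (suc j) * det (minor M (suc j)))
      ≡⟨ cong₂ _+_ (cong (λ z → + 1 * z * det (minor M zero)) (trans (e zero) (δ-refl {suc n} zero)))
                   (sumF-zero _ λ j → trans (cong (λ z → sgn (suc j) * z * det (minor M (suc j))) (e (suc j)))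
                                            (trans (cong (_* det (minor M (suc j))) (ℤP.*-zeroʳ (sgn (suc j))))
                                                   (ℤP.*-zeroˡ (det (minor M (suc j)))))) ⟩
    + 1 * + 1 * det (minor M zero) + + 0
      ≡⟨ trans (ℤP.+-identityʳ _) (ℤP.*-identityˡ _) ⟩
    det (minor M zero) ∎
    where open ≡-Reasoning

  -- Follow the orbit of 0 until it leaves: the row of 0 becomes e_0, and expanding
  -- along it leaves the graph matrix of the contracted map.
  det-graphMatrix-halting : ∀ {m} (h : Fin m → Maybe (Fin m)) → Halting h → det (graphMatrix h) ≡ + 1
  det-graphMatrix-halting {zero} h halts = refl
  det-graphMatrix-halting {suc m} h halts with halts zero
  ... | (k , ek) with least (λ k → iterate h k zero ≡ nothing) (λ k → ≟nothing (iterate h k zero)) k ek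
  ...   | (zero , _ , () , _)
  ...   | (suc K , _ , eK , minimal) = begin
    det (graphMatrix h)                            ≡⟨ det-orbitRowMatrix h zero K avoids ⟨
    det (orbitRowMatrix h zero K)                  ≡⟨ det-unit-row₀ (orbitRowMatrix h zero K) row₀ ⟩
    det (minor (orbitRowMatrix h zero K) zero)     ≡⟨ det-cong minor≡ ⟩
    det (graphMatrix (contract h))                 ≡⟨ det-graphMatrix-halting (contract h) (halting-contract h halts) ⟩
    + 1 ∎
    where
      open ≡-Reasoning
      avoids : OrbitAvoids h zero K
      avoids (suc v) _ v<K with iterate h (suc v) zero in eq
      ... | nothing      = ⊥-elim (minimal (suc v) (s≤s v<K) eq)
      ... | just zero    = ⊥-elim (periodic⇒iterate-just h (suc v) zero (s≤s z≤n) eq k ek)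
      ... | just (suc y) = suc y , refl , λ ()
      row₀ : ∀ b → orbitRowMatrix h zero K zero b ≡ δ zero b
      row₀ b = trans (orbitRowMatrix-x h zero K b)
                     (trans (cong (λ z → δ zero b - pointsTo z b) eK) (ℤP.+-identityʳ _))
      pointsTo-contract : ∀ a b → pointsTo (h (suc a)) (suc b) ≡ pointsTo (contract h a) b
      pointsTo-contract a b with h (suc a)
      ... | nothing      = refl
      ... | just zero    = refl
      ... | just (suc c) = δ-suc c b
      minor≡ : ∀ a b → minor (orbitRowMatrix h zero K) zero a b ≡ graphMatrix (contract h) a b
      minor≡ a b = trans (orbitRowMatrix-other h zero K (suc a) (suc b) (λ ()))
                         (cong₂ _-_ (δ-suc a b) (pointsTo-contract a b))

  -- Pigeonhole: among the first m+1 points of a non-halting orbit one repeats.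
  non-halting⇒periodic : ∀ {m} (h : Fin m → Maybe (Fin m)) a → iterate h m a ≢ nothing →
    Σ ℕ λ i → Σ (Fin m) λ x → Σ ℕ λ u → 1 ≤ u × iterate h i a ≡ just x × iterate h u x ≡ just x
  non-halting⇒periodic {suc m} h a never
    with FinP.pigeonhole (ℕP.n<1+n (suc m)) (λ k → fromMaybe zero (iterate h (toℕ k) a))
  ... | (i , j , i<j , same) = toℕ i , _ , toℕ j ℕ.∸ toℕ i , ℕP.m<n⇒0<n∸m i<j , isJust i , period
    where
      point : Maybe (Fin (suc m)) → Fin (suc m)
      point = fromMaybe zero
      isJust : ∀ (k : Fin (suc (suc m))) → iterate h (toℕ k) a ≡ just (point (iterate h (toℕ k) a))
      isJust k with iterate h (toℕ k) a in eq
      ... | just y  = refl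
      ... | nothing = ⊥-elim (never (trans (sym (cong (λ t → iterate h t a) (ℕP.m+[n∸m]≡n (ℕP.≤-pred (FinP.toℕ<n k)))))
                                           (iterate-nothing h (toℕ k) (suc m ℕ.∸ toℕ k) a eq)))
      period : iterate h (toℕ j ℕ.∸ toℕ i) (point (iterate h (toℕ i) a)) ≡ just (point (iterate h (toℕ i) a))
      period = trans (sym (cong (_>>= iterate h (toℕ j ℕ.∸ toℕ i)) (isJust i)))
        (trans (sym (iterate-+ h (toℕ i) (toℕ j ℕ.∸ toℕ i) a))
          (trans (cong (λ t → iterate h t a) (ℕP.m+[n∸m]≡n (ℕP.<⇒≤ i<j)))
                 (trans (isJust j) (cong just (sym same)))))

  halting⇒haltingWithin : ∀ {m} (h : Fin m → Maybe (Fin m)) → Halting h → HaltingWithin h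
  halting⇒haltingWithin {m} h halts a with ≟nothing (iterate h m a)
  ... | yes e = e
  ... | no never with non-halting⇒periodic h a never | halts a
  ...   | (i , x , u , 1≤u , ei , eu) | (k , ek) = ⊥-elim (reaches-periodic⇒iterate-just h i u a x 1≤u ei eu k ek)

  indicator : Bool → ℤ
  indicator b = if b then + 1 else + 0

  ι : ∀ {P : Set} → Dec P → ℤ
  ι P? = indicator (does P?)

  det-graphMatrix : ∀ {m} (h : Fin m → Maybe (Fin m)) → det (graphMatrix h) ≡ ι (haltingWithin? h)
  det-graphMatrix {m} h = byCases (haltingWithin? h)
    where
      byCases : (halts? : Dec (HaltingWithin h)) → det (graphMatrix h) ≡ ι halts?
      byCases (yes halts) = det-graphMatrix-halting h (haltingWithin⇒halting h halts)
      byCases (no ¬halts) with FinP.¬∀⟶∃¬ m (λ a → iterate h m a ≡ nothing) (λ a → ≟nothing (iterate h m a)) ¬halts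
      ... | (a , never) with non-halting⇒periodic h a never
      ...   | (_ , x , u , 1≤u , _ , eu) = det-graphMatrix-periodic h x u 1≤u eu

  -- Multilinear expansion of the determinant

  -- Sum over all choice vectors v, i.e. all maps Fin m → Fin K.
  sumChoices : ∀ {m K} → (Vec (Fin K) m → ℤ) → ℤ
  sumChoices {zero}  F = F []
  sumChoices {suc m} F = sumF (λ k → sumChoices (λ v → F (k ∷ v)))

  prodF : ∀ {n} → (Fin n → ℤ) → ℤ
  prodF {zero}  f = + 1
  prodF {suc n} f = f zero * prodF (f ∘ suc)

  sumChoices-cong : ∀ {m K} {F G : Vec (Fin K) m → ℤ} → (∀ v → F v ≡ G v) → sumChoices F ≡ sumChoices G
  sumChoices-cong {zero}  e = e []
  sumChoices-cong {suc m} e = sumF-cong λ k → sumChoices-cong λ v → e (k ∷ v)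

  *-distribˡ-sumChoices : ∀ {m K} (c : ℤ) (F : Vec (Fin K) m → ℤ) → c * sumChoices F ≡ sumChoices (λ v → c * F v)
  *-distribˡ-sumChoices {zero}  c F = refl
  *-distribˡ-sumChoices {suc m} c F =
    trans (*-distribˡ-sumF c (λ k → sumChoices (λ v → F (k ∷ v))))
          (sumF-cong λ k → *-distribˡ-sumChoices c (λ v → F (k ∷ v)))

  sumChoices-distrib-+ : ∀ {m K} (F G : Vec (Fin K) m → ℤ) → sumChoices (λ v → F v + G v) ≡ sumChoices F + sumChoices G
  sumChoices-distrib-+ {zero}  F G = refl
  sumChoices-distrib-+ {suc m} F G =
    trans (sumF-cong λ k → sumChoices-distrib-+ (λ v → F (k ∷ v)) (λ v → G (k ∷ v)))
          (sumF-distrib-+ (λ k → sumChoices (λ v → F (k ∷ v))) (λ k → sumChoices (λ v → G (k ∷ v))))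

  neg-distrib-sumChoices : ∀ {m K} (F : Vec (Fin K) m → ℤ) → sumChoices (λ v → - F v) ≡ - sumChoices F
  neg-distrib-sumChoices {zero}  F = refl
  neg-distrib-sumChoices {suc m} F =
    trans (sumF-cong λ k → neg-distrib-sumChoices (λ v → F (k ∷ v))) (neg-distrib-sumF (λ k → sumChoices (λ v → F (k ∷ v))))

  sumF-sumChoices-comm : ∀ {n m K} (F : Fin n → Vec (Fin K) m → ℤ) →
    sumF (λ j → sumChoices (F j)) ≡ sumChoices (λ v → sumF (λ j → F j v))
  sumF-sumChoices-comm {m = zero}  F = refl
  sumF-sumChoices-comm {m = suc m} F = trans (sumF-comm (λ j k → sumChoices (λ v → F j (k ∷ v))))
    (sumF-cong λ k → sumF-sumChoices-comm (λ j v → F j (k ∷ v)))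

  -- Row a of the matrix is Σ_k c a k · V a k; expanding every row chooses one k = v[a] per row.
  det-multilinear : ∀ {m K} (c : Fin m → Fin K → ℤ) (V : Fin m → Fin K → Fin m → ℤ) →
    det (λ a b → sumF (λ k → c a k * V a k b)) ≡
    sumChoices (λ v → prodF (λ a → c a (lookup v a)) * det (λ a b → V a (lookup v a) b))
  det-multilinear {zero}      c V = refl
  det-multilinear {suc m} {K} c V = begin
    sumF (λ j → sgn j * sumF (λ k → c zero k * V zero k j) * det (λ a b → sumF (λ k → c (suc a) k * V (suc a) k (punchIn j b))))
      ≡⟨ sumF-cong expand-rest ⟩
    sumF (λ j → sumF (λ k → sumChoices (λ w → sgn j * (c zero k * V zero k j) * g j w)))
      ≡⟨ sumF-comm (λ j k → sumChoices (λ w → sgn j * (c zero k * V zero k j) * g j w)) ⟩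
    sumF (λ k → sumF (λ j → sumChoices (λ w → sgn j * (c zero k * V zero k j) * g j w)))
      ≡⟨ sumF-cong (λ k → sumF-sumChoices-comm (λ j w → sgn j * (c zero k * V zero k j) * g j w)) ⟩
    sumF (λ k → sumChoices (λ w → sumF (λ j → sgn j * (c zero k * V zero k j) * g j w)))
      ≡⟨ sumF-cong (λ k → sumChoices-cong λ w → sym (collect k w)) ⟩
    sumF (λ k → sumChoices (λ w → c zero k * prodF (λ a → c (suc a) (lookup w a)) * det (λ a b → V a (lookup (k ∷ w) a) b))) ∎
    where
      open ≡-Reasoning
      g : Fin (suc m) → Vec (Fin K) m → ℤ
      g j w = prodF (λ a → c (suc a) (lookup w a)) * det (λ a b → V (suc a) (lookup w a) (punchIn j b))
      expand-rest : ∀ j → sgn j * sumF (λ k → c zero k * V zero k j) * det (λ a b → sumF (λ k → c (suc a) k * V (suc a) k (punchIn j b)))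
                        ≡ sumF (λ k → sumChoices (λ w → sgn j * (c zero k * V zero k j) * g j w))
      expand-rest j =
        trans (cong (sgn j * sumF (λ k → c zero k * V zero k j) *_) (det-multilinear (c ∘ suc) (λ a k b → V (suc a) k (punchIn j b))))
          (trans (cong (_* sumChoices (g j)) (*-distribˡ-sumF (sgn j) (λ k → c zero k * V zero k j)))
            (trans (*-distribʳ-sumF (sumChoices (g j)) (λ k → sgn j * (c zero k * V zero k j)))
                   (sumF-cong λ k → *-distribˡ-sumChoices (sgn j * (c zero k * V zero k j)) (g j))))
      regroup = solve 5 (λ s c v p d → (c :* p) :* (s :* v :* d) := s :* (c :* v) :* (p :* d)) refl
      collect : ∀ k w → c zero k * prodF (λ a → c (suc a) (lookup w a)) * det (λ a b → V a (lookup (k ∷ w) a) b)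
                      ≡ sumF (λ j → sgn j * (c zero k * V zero k j) * g j w)
      collect k w =
        trans (*-distribˡ-sumF (c zero k * prodF (λ a → c (suc a) (lookup w a)))
                               (λ j → sgn j * V zero k j * det (λ a b → V (suc a) (lookup w a) (punchIn j b))))
              (sumF-cong λ j → regroup (sgn j) (c zero k) (V zero k j) (prodF (λ a → c (suc a) (lookup w a)))
                                       (det (λ a b → V (suc a) (lookup w a) (punchIn j b))))

  -- Vertex k renumbered for the minor at i; i itself is deleted.
  punchOut? : ∀ {m} → Fin (suc m) → Fin (suc m) → Maybe (Fin m)
  punchOut? i k with i FinP.≟ k
  ... | yes _   = nothing
  ... | no i≢k = just (punchOut i≢k)

  punchOut?-i : ∀ {m} (i : Fin (suc m)) → punchOut? i i ≡ nothing
  punchOut?-i i with i FinP.≟ i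
  ... | yes _  = refl
  ... | no i≢i = ⊥-elim (i≢i refl)

  punchOut?-punchIn : ∀ {m} (i : Fin (suc m)) c → punchOut? i (punchIn i c) ≡ just c
  punchOut?-punchIn i c with i FinP.≟ punchIn i c
  ... | yes i≡ = ⊥-elim (FinP.punchInᵢ≢i i c (sym i≡))
  ... | no _   = cong just (trans (FinP.punchOut-cong i refl) (FinP.punchOut-punchIn i))

  sumF-δ : ∀ {m} (g : Fin m → ℤ) b → sumF (λ c → g c * δ c b) ≡ g b
  sumF-δ {suc m} g b = begin
    sumF (λ c → g c * δ c b)
      ≡⟨ sumF-remove (λ c → g c * δ c b) b ⟩
    g b * δ b b + sumF (λ d → g (punchIn b d) * δ (punchIn b d) b)
      ≡⟨ cong₂ _+_ (trans (cong (g b *_) (δ-refl b)) (ℤP.*-identityʳ (g b)))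
                   (sumF-zero _ λ d → trans (cong (g (punchIn b d) *_) (δ-≢ _ _ (FinP.punchInᵢ≢i b d)))
                                            (ℤP.*-zeroʳ (g (punchIn b d)))) ⟩
    g b + + 0
      ≡⟨ ℤP.+-identityʳ (g b) ⟩
    g b ∎
    where open ≡-Reasoning

  sumF-pointsTo-punchOut? : ∀ {m} (i : Fin (suc m)) (f : Fin (suc m) → ℤ) b →
    sumF (λ k → f k * pointsTo (punchOut? i k) b) ≡ f (punchIn i b)
  sumF-pointsTo-punchOut? i f b = begin
    sumF (λ k → f k * pointsTo (punchOut? i k) b)
      ≡⟨ sumF-remove (λ k → f k * pointsTo (punchOut? i k) b) i ⟩
    f i * pointsTo (punchOut? i i) b + sumF (λ c → f (punchIn i c) * pointsTo (punchOut? i (punchIn i c)) b)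
      ≡⟨ cong₂ _+_ (trans (cong (λ z → f i * pointsTo z b) (punchOut?-i i)) (ℤP.*-zeroʳ (f i)))
                   (sumF-cong λ c → cong (λ z → f (punchIn i c) * pointsTo z b) (punchOut?-punchIn i c)) ⟩
    + 0 + sumF (λ c → f (punchIn i c) * δ c b)
      ≡⟨ trans (ℤP.+-identityˡ _) (sumF-δ (λ c → f (punchIn i c)) b) ⟩
    f (punchIn i b) ∎
    where open ≡-Reasoning

  -- The Laplacian D − W of a weight matrix W; lapAbs A = laplacian (absAdj A) and netLap A = laplacian A.
  laplacian : ∀ {n} → Matrix n → Matrix n
  laplacian W i j = (if does (i FinP.≟ j) then sumF (λ k → W i k) else + 0) - W i j

  principalMinor-laplacian : ∀ {m} (W : Matrix (suc m)) i a b →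
    principalMinor i (laplacian W) a b ≡ sumF (λ k → W (punchIn i a) k * (δ a b - pointsTo (punchOut? i k) b))
  principalMinor-laplacian W i a b = sym (begin
    sumF (λ k → w k * (δ a b - pointsTo (punchOut? i k) b))
      ≡⟨ sumF-cong (λ k → distrib (w k) (δ a b) (pointsTo (punchOut? i k) b)) ⟩
    sumF (λ k → δ a b * w k + - (w k * pointsTo (punchOut? i k) b))
      ≡⟨ sumF-distrib-+ (λ k → δ a b * w k) (λ k → - (w k * pointsTo (punchOut? i k) b)) ⟩
    sumF (λ k → δ a b * w k) + sumF (λ k → - (w k * pointsTo (punchOut? i k) b))
      ≡⟨ cong₂ _+_ (trans (sym (*-distribˡ-sumF (δ a b) w)) (sym diagonal))
                   (trans (neg-distrib-sumF (λ k → w k * pointsTo (punchOut? i k) b))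
                          (cong -_ (sumF-pointsTo-punchOut? i w b))) ⟩
    principalMinor i (laplacian W) a b ∎)
    where
      open ≡-Reasoning
      w = W (punchIn i a)
      distrib = solve 3 (λ w d e → w :* (d :- e) := d :* w :+ (:- (w :* e))) refl
      diagonal : (if does (punchIn i a FinP.≟ punchIn i b) then sumF w else + 0) ≡ δ a b * sumF w
      diagonal with a FinP.≟ b | punchIn i a FinP.≟ punchIn i b
      ... | yes refl | yes _ = sym (ℤP.*-identityˡ _)
      ... | yes refl | no ≢  = ⊥-elim (≢ refl)
      ... | no a≢b   | yes ≡ = ⊥-elim (a≢b (FinP.punchIn-injective i a b ≡))
      ... | no _     | no _  = sym (ℤP.*-zeroˡ (sumF w))

  choiceMap : ∀ {m} → Fin (suc m) → Vec (Fin (suc m)) m → Fin m → Maybe (Fin m)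
  choiceMap i v a = punchOut? i (lookup v a)

  -- Weighted matrix-tree theorem, with spanning trees still encoded as halting choice maps.
  det-principalMinor-laplacian : ∀ {m} (W : Matrix (suc m)) i →
    det (principalMinor i (laplacian W)) ≡
    sumChoices (λ v → prodF (λ a → W (punchIn i a) (lookup v a)) * ι (haltingWithin? (choiceMap i v)))
  det-principalMinor-laplacian W i = begin
    det (principalMinor i (laplacian W))
      ≡⟨ det-cong (principalMinor-laplacian W i) ⟩
    det (λ a b → sumF (λ k → W (punchIn i a) k * (δ a b - pointsTo (punchOut? i k) b)))
      ≡⟨ det-multilinear (λ a k → W (punchIn i a) k) (λ a k b → δ a b - pointsTo (punchOut? i k) b) ⟩
    sumChoices (λ v → prodF (λ a → W (punchIn i a) (lookup v a)) * det (graphMatrix (choiceMap i v)))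
      ≡⟨ sumChoices-cong (λ v → cong (prodF (λ a → W (punchIn i a) (lookup v a)) *_) (det-graphMatrix (choiceMap i v))) ⟩
    sumChoices (λ v → prodF (λ a → W (punchIn i a) (lookup v a)) * ι (haltingWithin? (choiceMap i v))) ∎
    where open ≡-Reasoning

  module _ {X : Set} where

    Unique-∷ : ∀ {x : X} {xs} → x ∉ xs → Unique xs → Unique (x ∷ xs)
    Unique-∷ {xs = xs} x∉xs u = ¬Any⇒All¬ xs x∉xs AllPairs.∷ u

    Unique-++ˡ : ∀ (xs : List X) {ys} → Unique (xs ++ ys) → Unique xs
    Unique-++ˡ []       u = AllPairs.[]
    Unique-++ˡ (x ∷ xs) u = Unique-∷ (Unique[x∷xs]⇒x∉xs u ∘ ∈-++⁺ˡ) (Unique-++ˡ xs (AllPairs.tail u))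

    Unique-++-mid : ∀ (xs : List X) {c ys} → Unique (xs ++ c ∷ ys) → c ∉ xs
    Unique-++-mid (x ∷ xs) u (here refl) = Unique[x∷xs]⇒x∉xs u (∈-++⁺ʳ xs (here refl))
    Unique-++-mid (x ∷ xs) u (there c∈) = Unique-++-mid xs (AllPairs.tail u) c∈

    ʳ++-++-assoc : ∀ (xs ys zs : List X) → (xs ʳ++ ys) ++ zs ≡ xs ʳ++ (ys ++ zs)
    ʳ++-++-assoc []       ys zs = refl
    ʳ++-++-assoc (x ∷ xs) ys zs = ʳ++-++-assoc xs (x ∷ ys) zs

    ∈-ʳ++⁻ : ∀ xs ys {w : X} → w ∈ xs ʳ++ ys → w ∈ xs ⊎ w ∈ ys
    ∈-ʳ++⁻ []       ys w∈ = inj₂ w∈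
    ∈-ʳ++⁻ (x ∷ xs) ys w∈ with ∈-ʳ++⁻ xs (x ∷ ys) w∈
    ... | inj₁ w∈xs         = inj₁ (there w∈xs)
    ... | inj₂ (here w≡x)   = inj₁ (here w≡x)
    ... | inj₂ (there w∈ys) = inj₂ w∈ys

    Unique-ʳ++ : ∀ xs ys → Unique xs → Unique ys → (∀ {w : X} → w ∈ xs → w ∉ ys) → Unique (xs ʳ++ ys)
    Unique-ʳ++ []       ys _ uys _ = uys
    Unique-ʳ++ (x ∷ xs) ys uxs uys disjoint =
      Unique-ʳ++ xs (x ∷ ys) (AllPairs.tail uxs) (Unique-∷ (disjoint (here refl)) uys) disjoint′
      where
        disjoint′ : ∀ {w} → w ∈ xs → w ∉ x ∷ ys
        disjoint′ w∈xs (here refl)   = Unique[x∷xs]⇒x∉xs uxs w∈xs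
        disjoint′ w∈xs (there w∈ys) = disjoint (there w∈xs) w∈ys

    Unique-++-∷-ʳ++ : ∀ (xs : List X) c ys zs ws → Unique (xs ++ c ∷ ys) → Unique (zs ++ c ∷ ws) →
      All (_∉ (zs ++ c ∷ ws)) xs → Unique (xs ++ c ∷ zs ʳ++ [])
    Unique-++-∷-ʳ++ xs c ys zs ws uxs uzs disjoint = UniqueP.++⁺ (Unique-++ˡ xs uxs)
      (Unique-∷ c∉zsʳ (Unique-ʳ++ zs [] (Unique-++ˡ zs uzs) AllPairs.[] (λ _ ())))
      (λ (w∈xs , w∈) → separate (All.lookup disjoint w∈xs) w∈)
      where
        c∉zsʳ : c ∉ zs ʳ++ []
        c∉zsʳ c∈ with ∈-ʳ++⁻ zs [] c∈
        ... | inj₁ c∈zs = Unique-++-mid zs uzs c∈zs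
        separate : ∀ {w} → w ∉ zs ++ c ∷ ws → w ∉ c ∷ zs ʳ++ []
        separate w∉ (here refl) = w∉ (∈-++⁺ʳ zs (here refl))
        separate w∉ (there w∈) with ∈-ʳ++⁻ zs [] w∈
        ... | inj₁ w∈zs = w∉ (∈-++⁺ˡ w∈zs)

    module _ {R : X → X → Set} where

      Linked-ʳ++ : ∀ x xs ys → Linked (flip R) (x ∷ xs) → Linked R (x ∷ ys) → Linked R (xs ʳ++ (x ∷ ys))
      Linked-ʳ++ x []       ys _          lys = lys
      Linked-ʳ++ x (y ∷ xs) ys (e ∷ lxs) lys = Linked-ʳ++ y xs (x ∷ ys) lxs (e ∷ lys)

      Linked-prefix : ∀ (xs : List X) {c ys} → Linked R (xs ++ c ∷ ys) → Linked R (xs ++ c ∷ [])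
      Linked-prefix []           _          = [-]
      Linked-prefix (x ∷ [])     (e ∷ _)    = e ∷ [-]
      Linked-prefix (x ∷ y ∷ xs) (e ∷ rest) = e ∷ Linked-prefix (y ∷ xs) rest

      Linked-join : ∀ (xs : List X) {c ys} → Linked R (xs ++ c ∷ []) → Linked R (c ∷ ys) → Linked R (xs ++ c ∷ ys)
      Linked-join []           _               lys = lys
      Linked-join (x ∷ [])     (e ∷ [-])       lys = e ∷ lys
      Linked-join (x ∷ y ∷ xs) (e ∷ lxs)       lys = e ∷ Linked-join (y ∷ xs) lxs lys

    Linked-map : ∀ {R S : X → X → Set} → (∀ {x y} → R x y → S x y) → ∀ {xs} → Linked R xs → Linked S xs
    Linked-map f []         = []
    Linked-map f [-]        = [-]
    Linked-map f (e ∷ rest) = f e ∷ Linked-map f rest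

  Unique-map-injectiveOn : ∀ {X Y : Set} (f : X → Y) (xs : List X) → Unique xs →
    (∀ {x y} → x ∈ xs → y ∈ xs → f x ≡ f y → x ≡ y) → Unique (map f xs)
  Unique-map-injectiveOn f []       _ _ = AllPairs.[]
  Unique-map-injectiveOn f (x ∷ xs) (x∉ AllPairs.∷ u) injective =
    All.tabulate (λ {w} w∈ fx≡w → let (y , y∈ , w≡fy) = MemP.∈-map⁻ f w∈ in
      All.lookup x∉ y∈ (injective (here refl) (there y∈) (trans fx≡w w≡fy)))
    AllPairs.∷ Unique-map-injectiveOn f xs u (λ x∈ y∈ → injective (there x∈) (there y∈))

  module _ {n} {R : Fin n → Fin n → Set} where

    walk-++ : ∀ {x y z} → Walk R x y → Walk R y z → Walk R x z
    walk-++ here       w = w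
    walk-++ (step e v) w = step e (walk-++ v w)

    walk-reverse : (∀ {x y} → R x y → R y x) → ∀ {x y} → Walk R x y → Walk R y x
    walk-reverse sym-R here       = here
    walk-reverse sym-R (step e w) = walk-++ (walk-reverse sym-R w) (step (sym-R e) here)

  -- Rooted trees given by a parent map

  ParentEdge′ : ∀ {n} → (Fin n → Maybe (Fin n)) → Fin n → Fin n → Set
  ParentEdge′ parent a b = (parent a ≡ just b) ⊎ (parent b ≡ just a)

  module RootedTree {n : ℕ} (parent : Fin n → Maybe (Fin n)) (root : Fin n)
                    (only-root-orphan : ∀ x → parent x ≡ nothing → x ≡ root) (halts : Halting parent) where

    private
      firstExit : (x : Fin n) →
        Σ ℕ λ K → K ≤ proj₁ (halts x) × iterate parent K x ≡ nothing × (∀ j → j < K → iterate parent j x ≢ nothing)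
      firstExit x = least (λ k → iterate parent k x ≡ nothing) (λ k → ≟nothing (iterate parent k x))
                          (proj₁ (halts x)) (proj₂ (halts x))

    -- One more than the distance to the root.
    height : Fin n → ℕ
    height x = proj₁ (firstExit x)

    height-minimal : ∀ x j → iterate parent j x ≡ nothing → height x ≤ j
    height-minimal x j e = ℕP.≮⇒≥ (λ j<h → proj₂ (proj₂ (proj₂ (firstExit x))) j j<h e)

    height-parent : ∀ {x y} → parent x ≡ just y → height y < height x
    height-parent {x} {y} e = below (height x) (proj₁ (proj₂ (proj₂ (firstExit x))))
      where
        below : ∀ K → iterate parent K x ≡ nothing → height y < K
        below zero    ()
        below (suc k) eK = s≤s (height-minimal y k
          (trans (sym (cong (_>>= iterate parent k) e)) (trans (sym (iterate-+ parent 1 k x)) eK)))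

    parent-irreflexive : ∀ {x} → parent x ≢ just x
    parent-irreflexive e = ℕP.<-irrefl refl (height-parent e)

    walk-to-root : (R : Fin n → Fin n → Set) → (∀ {x y} → parent x ≡ just y → R x y) → ∀ x → Walk R x root
    walk-to-root R parent⇒R x = go (suc (height x)) x ℕP.≤-refl
      where
        go : ∀ k x → height x < k → Walk R x root
        go (suc k) x h<k with parent x in eq
        ... | nothing = subst (λ z → Walk R z root) (sym (only-root-orphan x eq)) here
        ... | just y  = step (parent⇒R eq) (go k y (ℕP.<-≤-trans (height-parent eq) (ℕP.≤-pred h<k)))

    ParentEdge : Fin n → Fin n → Set
    ParentEdge = ParentEdge′ parent

    -- A path a, l…, z of parent edges, with consecutive edges never doubling back.
    second : List (Fin n) → Fin n → Fin n
    second []      z = z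
    second (b ∷ l) z = b

    penultimate : Fin n → List (Fin n) → Fin n
    penultimate a []      = a
    penultimate a (b ∷ l) = penultimate b l

    ParentPath : Fin n → List (Fin n) → Fin n → Set
    ParentPath a []      z = ParentEdge a z
    ParentPath a (b ∷ l) z = ParentEdge a b × ParentPath b l z

    NoBacktrack : Fin n → List (Fin n) → Fin n → Set
    NoBacktrack a []      z = ⊤
    NoBacktrack a (b ∷ l) z = a ≢ second l z × NoBacktrack b l z

    data PathShape (a : Fin n) (l : List (Fin n)) (z : Fin n) : Set where
      ascending  : height z < height a → parent a ≡ just (second l z) → parent (penultimate a l) ≡ just z → PathShape a l z
      descending : height a < height z → parent (second l z) ≡ just a → parent z ≡ just (penultimate a l) → PathShape a l z
      peaked     : parent a ≡ just (second l z) → parent z ≡ just (penultimate a l) → PathShape a l z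

    pathShape : ∀ a l z → ParentPath a l z → NoBacktrack a l z → PathShape a l z
    pathShape a []      z (inj₁ up)   _ = ascending (height-parent up) up up
    pathShape a []      z (inj₂ down) _ = descending (height-parent down) down down
    pathShape a (b ∷ l) z (edge , path) (a≢ , noBack) with pathShape b l z path noBack | edge
    ... | ascending lt _ last  | inj₁ up   = ascending (ℕP.<-trans lt (height-parent up)) up last
    ... | descending _ _ last  | inj₁ up   = peaked up last
    ... | peaked _ last        | inj₁ up   = peaked up last
    ... | ascending _ first _  | inj₂ down = ⊥-elim (a≢ (MaybeP.just-injective (trans (sym down) first)))
    ... | descending lt _ last | inj₂ down = descending (ℕP.<-trans (height-parent down) lt) down last
    ... | peaked first _       | inj₂ down = ⊥-elim (a≢ (MaybeP.just-injective (trans (sym down) first)))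

    noBacktrack : ∀ a l z → Unique (a ∷ l) → z ∉ a ∷ l → NoBacktrack a l z
    noBacktrack a []      z _ _ = tt
    noBacktrack a (b ∷ [])    z _ z∉ = (λ a≡z → z∉ (here (sym a≡z))) , tt
    noBacktrack a (b ∷ c ∷ l) z u z∉ =
      (λ a≡c → Unique[x∷xs]⇒x∉xs u (there (here a≡c))) , noBacktrack b (c ∷ l) z (AllPairs.tail u) (z∉ ∘ there)

    penultimate∈ : ∀ a l → penultimate a l ∈ a ∷ l
    penultimate∈ a []      = here refl
    penultimate∈ a (b ∷ l) = there (penultimate∈ b l)

    toParentPath : (R : Fin n → Fin n → Set) → (∀ x y → R x y → ParentEdge x y) →
      ∀ a l z → Linked R (a ∷ l ++ z ∷ []) → ParentPath a l z
    toParentPath R R⇒parent a []      z (e ∷ [-])  = R⇒parent a z e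
    toParentPath R R⇒parent a (b ∷ l) z (e ∷ rest) = R⇒parent a b e , toParentPath R R⇒parent b l z rest

    -- A cycle would be a closed path without backtracking, whose shape is impossible.
    parentEdges-acyclic : (R : Fin n → Fin n → Set) → (∀ x y → R x y → ParentEdge x y) → Acyclic R
    parentEdges-acyclic R R⇒parent (x ∷ [])          (_ , s≤s () , _)
    parentEdges-acyclic R R⇒parent (x ∷ c₁ ∷ [])     (_ , s≤s (s≤s ()) , _)
    parentEdges-acyclic R R⇒parent (x ∷ c₁ ∷ c₂ ∷ xs) (u , _ , closed)
      with pathShape x (c₁ ∷ c₂ ∷ xs) x (toParentPath R R⇒parent x (c₁ ∷ c₂ ∷ xs) x closed)
                     ((λ x≡c₂ → Unique[x∷xs]⇒x∉xs u (there (here x≡c₂)))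
                     , noBacktrack c₁ (c₂ ∷ xs) x (AllPairs.tail u) (Unique[x∷xs]⇒x∉xs u))
    ... | ascending lt _ _  = ℕP.<-irrefl refl lt
    ... | descending lt _ _ = ℕP.<-irrefl refl lt
    ... | peaked first last = Unique[x∷xs]⇒x∉xs (AllPairs.tail u)
            (subst (_∈ c₂ ∷ xs) (sym (MaybeP.just-injective (trans (sym first) last))) (penultimate∈ c₂ xs))

    parent-unique : (parent′ : Fin n → Maybe (Fin n)) → parent′ root ≡ nothing →
      (∀ x y → parent x ≡ just y → ParentEdge′ parent′ x y) → ∀ x → parent′ x ≡ parent x
    parent-unique parent′ orphan edges x = go (suc (height x)) x ℕP.≤-refl
      where
        go : ∀ k x → height x < k → parent′ x ≡ parent x
        go (suc k) x h<k with parent x in eq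
        ... | nothing = subst (λ z → parent′ z ≡ nothing) (sym (only-root-orphan x eq)) orphan
        ... | just y with edges x y eq
        ...   | inj₁ e = e
        ...   | inj₂ e = ⊥-elim (ℕP.<-asym (height-parent eq)
                          (height-parent (trans (sym (go k y (ℕP.<-≤-trans (height-parent eq) (ℕP.≤-pred h<k)))) e)))

    IsParent : Fin n → Fin n → Set
    IsParent x y = parent x ≡ just y

    ancestors : ℕ → Fin n → List (Fin n)
    ancestors zero    x = []
    ancestors (suc k) x = x ∷ maybe′ (ancestors k) [] (parent x)

    ancestors-linked : ∀ k x → Linked IsParent (ancestors (suc k) x)
    ancestors-linked zero    x with parent x
    ... | nothing = [-]
    ... | just _  = [-]
    ancestors-linked (suc k) x with parent x in eq
    ... | nothing = [-]
    ... | just y  = eq ∷ ancestors-linked k y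

    ancestors-below : ∀ k x → All (λ w → height w ≤ height x) (ancestors k x)
    ancestors-below zero    x = []
    ancestors-below (suc k) x with parent x in eq
    ... | nothing = ℕP.≤-refl ∷ []
    ... | just y  = ℕP.≤-refl ∷ All.map (λ h≤ → ℕP.≤-trans h≤ (ℕP.<⇒≤ (height-parent eq))) (ancestors-below k y)

    ancestors-unique : ∀ k x → Unique (ancestors k x)
    ancestors-unique zero    x = AllPairs.[]
    ancestors-unique (suc k) x with parent x in eq
    ... | nothing = Unique-∷ (λ ()) AllPairs.[]
    ... | just y  = Unique-∷ (λ x∈ → ℕP.<⇒≱ (height-parent eq) (All.lookup (ancestors-below k y) x∈))
                             (ancestors-unique k y)

    root∈ancestors : ∀ k x → height x < k → root ∈ ancestors k x
    root∈ancestors (suc k) x h<k with parent x in eq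
    ... | nothing = here (sym (only-root-orphan x eq))
    ... | just y  = there (root∈ancestors k y (ℕP.<-≤-trans (height-parent eq) (ℕP.≤-pred h<k)))

    allAncestors : Fin n → List (Fin n)
    allAncestors x = ancestors (suc (height x)) x

    open import Data.List.Membership.DecPropositional (FinP._≟_ {n}) using (_∈?_)

    firstCommon : ∀ (as bs : List (Fin n)) {w} → w ∈ as → w ∈ bs →
      Σ (List (Fin n)) λ as₁ → Σ (Fin n) λ c → Σ (List (Fin n)) λ as₂ →
        as ≡ as₁ ++ c ∷ as₂ × c ∈ bs × All (_∉ bs) as₁
    firstCommon (y ∷ as) bs (here refl) w∈bs = [] , y , as , refl , w∈bs , []
    firstCommon (y ∷ as) bs (there w∈as) w∈bs with y ∈? bs
    ... | yes y∈bs = [] , y , as , refl , y∈bs , []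
    ... | no y∉bs  = let (as₁ , c , as₂ , e , c∈bs , before) = firstCommon as bs w∈as w∈bs in
                     y ∷ as₁ , c , as₂ , cong (y ∷_) e , c∈bs , y∉bs ∷ before

    headOr : List (Fin n) → Fin n → Fin n
    headOr []      d = d
    headOr (x ∷ _) d = x

    headOr-++ : ∀ (xs : List (Fin n)) c ys zs d → headOr (xs ++ c ∷ ys) d ≡ headOr (xs ++ c ∷ zs) d
    headOr-++ []       c ys zs d = refl
    headOr-++ (x ∷ xs) c ys zs d = refl

    ++-∷-headOr : ∀ (xs : List (Fin n)) c ys → Σ (List (Fin n)) λ zs → xs ++ c ∷ [] ≡ headOr (xs ++ c ∷ ys) root ∷ zs
    ++-∷-headOr []       c ys = [] , refl
    ++-∷-headOr (x ∷ xs) c ys = xs ++ c ∷ [] , refl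

    -- A symmetric, irreflexive, acyclic relation containing the parent edges contains nothing else.
    module _ (R : Fin n → Fin n → Set) (R-sym : ∀ {x y} → R x y → R y x) (R-acyclic : Acyclic R)
             (R-irrefl : ∀ x → ¬ R x x) (parent⇒R : ∀ {x y} → parent x ≡ just y → R x y) where

      no-cycle : ∀ xs → Unique xs → 3 ≤ length xs → Linked R (xs ++ headOr xs root ∷ []) → ⊥
      no-cycle []       _ () _
      no-cycle (x ∷ xs) u long closed = R-acyclic (x ∷ xs) (u , long , closed)

      ancestorCycle-long : ∀ a b c as₁ as₂ bs₁ bs₂ →
        headOr (as₁ ++ c ∷ as₂) root ≡ a → headOr (bs₁ ++ c ∷ bs₂) root ≡ b →
        Linked IsParent (as₁ ++ c ∷ as₂) → Linked IsParent (bs₁ ++ c ∷ bs₂) →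
        R a b → parent a ≢ just b → parent b ≢ just a → 3 ≤ length (as₁ ++ c ∷ bs₁ ʳ++ [])
      ancestorCycle-long a b c as₁ as₂ bs₁ bs₂ ha hb lA lB rab a↛b b↛a
        rewrite ListP.length-++ as₁ {c ∷ bs₁ ʳ++ []} | ListP.length-ʳ++ bs₁ {[]} = count as₁ bs₁ ha hb lA lB
        where
          count : ∀ as₁ bs₁ → headOr (as₁ ++ c ∷ as₂) root ≡ a → headOr (bs₁ ++ c ∷ bs₂) root ≡ b →
            Linked IsParent (as₁ ++ c ∷ as₂) → Linked IsParent (bs₁ ++ c ∷ bs₂) → 3 ≤ length as₁ ℕ.+ suc (length bs₁ ℕ.+ 0)
          count []           []           refl refl _        _        = ⊥-elim (R-irrefl c rab)
          count []           (y ∷ [])     refl refl _        (up ∷ _) = ⊥-elim (b↛a up)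
          count []           (y ∷ z ∷ _)  _    _    _        _        = s≤s (s≤s (s≤s z≤n))
          count (y ∷ [])     []           refl refl (up ∷ _) _        = ⊥-elim (a↛b up)
          count (y ∷ [])     (z ∷ _)      _    _    _        _        = s≤s (s≤s (s≤s z≤n))
          count (y ∷ x ∷ as) bs₁          _    _    _        _        =
            s≤s (s≤s (ℕP.≤-trans (s≤s z≤n) (ℕP.m≤n+m (suc (length bs₁ ℕ.+ 0)) (length as))))

      -- a ⋯ c ⋯ b → a, going up from a to the first common ancestor c and down to b.
      no-cycle-through-ancestors : ∀ a b c as₁ as₂ bs₁ bs₂ →
        Unique (as₁ ++ c ∷ as₂) → Unique (bs₁ ++ c ∷ bs₂) →
        Linked IsParent (as₁ ++ c ∷ as₂) → Linked IsParent (bs₁ ++ c ∷ bs₂) →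
        headOr (as₁ ++ c ∷ as₂) root ≡ a → headOr (bs₁ ++ c ∷ bs₂) root ≡ b → All (_∉ (bs₁ ++ c ∷ bs₂)) as₁ →
        R a b → parent a ≢ just b → parent b ≢ just a → ⊥
      no-cycle-through-ancestors a b c as₁ as₂ bs₁ bs₂ uA uB lA lB ha hb disjoint rab a↛b b↛a =
        no-cycle cycle (Unique-++-∷-ʳ++ as₁ c as₂ bs₁ bs₂ uA uB disjoint)
          (ancestorCycle-long a b c as₁ as₂ bs₁ bs₂ ha hb lA lB rab a↛b b↛a) (subst (Linked R) (sym closed) linked)
        where
          cycle = as₁ ++ c ∷ bs₁ ʳ++ []
          open ≡-Reasoning
          closed : cycle ++ headOr cycle root ∷ [] ≡ as₁ ++ c ∷ bs₁ ʳ++ (a ∷ [])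
          closed = begin
            cycle ++ headOr cycle root ∷ []
              ≡⟨ cong (λ h → cycle ++ h ∷ []) (trans (headOr-++ as₁ c (bs₁ ʳ++ []) as₂ root) ha) ⟩
            (as₁ ++ c ∷ bs₁ ʳ++ []) ++ a ∷ []    ≡⟨ ListP.++-assoc as₁ (c ∷ bs₁ ʳ++ []) (a ∷ []) ⟩
            as₁ ++ c ∷ (bs₁ ʳ++ []) ++ a ∷ []    ≡⟨ cong (λ zs → as₁ ++ c ∷ zs) (ʳ++-++-assoc bs₁ [] (a ∷ [])) ⟩
            as₁ ++ c ∷ bs₁ ʳ++ (a ∷ [])          ∎
          bsPath = ++-∷-headOr bs₁ c bs₂
          bs′ = proj₁ bsPath
          bs₁c≡ : bs₁ ++ c ∷ [] ≡ b ∷ bs′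
          bs₁c≡ = trans (proj₂ bsPath) (cong (_∷ bs′) hb)
          down : Linked R (c ∷ bs₁ ʳ++ (a ∷ []))
          down = subst (Linked R) (ListP.++-ʳ++ bs₁)
            (subst (λ zs → Linked R (zs ʳ++ (a ∷ []))) (sym bs₁c≡)
              (Linked-ʳ++ b bs′ (a ∷ [])
                (Linked-map R-sym (subst (Linked R) bs₁c≡ (Linked-prefix bs₁ (Linked-map parent⇒R lB))))
                (R-sym rab ∷ [-])))
          linked : Linked R (as₁ ++ c ∷ bs₁ ʳ++ (a ∷ []))
          linked = Linked-join as₁ (Linked-prefix as₁ (Linked-map parent⇒R lA)) down

      tree-edge⇒parentEdge : ∀ a b → R a b → ParentEdge a b
      tree-edge⇒parentEdge a b rab with MaybeP.≡-dec FinP._≟_ (parent a) (just b) | MaybeP.≡-dec FinP._≟_ (parent b) (just a)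
      ... | yes up | _       = inj₁ up
      ... | no _   | yes up  = inj₂ up
      ... | no a↛b | no b↛a =
        let (as₁ , c , as₂ , A≡ , c∈B , disjoint) = firstCommon (allAncestors a) (allAncestors b)
                                                      (root∈ancestors _ a ℕP.≤-refl) (root∈ancestors _ b ℕP.≤-refl)
            (bs₁ , bs₂ , B≡) = ∈-∃++ c∈B
        in ⊥-elim (no-cycle-through-ancestors a b c as₁ as₂ bs₁ bs₂
             (subst Unique A≡ (ancestors-unique _ a)) (subst Unique B≡ (ancestors-unique _ b))
             (subst (Linked IsParent) A≡ (ancestors-linked _ a)) (subst (Linked IsParent) B≡ (ancestors-linked _ b))
             (cong (λ l → headOr l root) (sym A≡)) (cong (λ l → headOr l root) (sym B≡))
             (subst (λ l → All (_∉ l) as₁) B≡ disjoint) rab a↛b b↛a)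

  sumList : List ℤ → ℤ
  sumList []       = + 0
  sumList (x ∷ xs) = x + sumList xs

  sumList-++ : ∀ xs ys → sumList (xs ++ ys) ≡ sumList xs + sumList ys
  sumList-++ []       ys = sym (ℤP.+-identityˡ _)
  sumList-++ (x ∷ xs) ys = trans (cong (_+_ x) (sumList-++ xs ys)) (sym (ℤP.+-assoc x _ _))

  sumF≡sumList-tabulate : ∀ {K} (g : Fin K → ℤ) → sumF g ≡ sumList (List.tabulate g)
  sumF≡sumList-tabulate {zero}  g = refl
  sumF≡sumList-tabulate {suc K} g = cong (_+_ (g zero)) (sumF≡sumList-tabulate (g ∘ suc))

  allChoices : ∀ m K → List (Vec (Fin K) m)
  allChoices zero    K = [] ∷ []
  allChoices (suc m) K = cartesianProductWith _∷_ (allFin K) (allChoices m K)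

  sumList-cartesianProduct : ∀ {m K} (F : Vec (Fin K) (suc m) → ℤ) (ks : List (Fin K)) (vs : List (Vec (Fin K) m)) →
    sumList (map F (cartesianProductWith _∷_ ks vs)) ≡ sumList (map (λ k → sumList (map (F ∘ (k ∷_)) vs)) ks)
  sumList-cartesianProduct F []       vs = refl
  sumList-cartesianProduct F (k ∷ ks) vs =
    trans (cong sumList (ListP.map-++ F (map (k ∷_) vs) _))
      (trans (sumList-++ (map F (map (k ∷_) vs)) _)
        (cong₂ _+_ (cong sumList (sym (ListP.map-∘ vs))) (sumList-cartesianProduct F ks vs)))

  sumChoices≡sumList : ∀ {m K} (F : Vec (Fin K) m → ℤ) → sumChoices F ≡ sumList (map F (allChoices m K))
  sumChoices≡sumList {zero}      F = sym (ℤP.+-identityʳ (F []))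
  sumChoices≡sumList {suc m} {K} F = begin
    sumF (λ k → sumChoices (F ∘ (k ∷_)))
      ≡⟨ sumF-cong (λ k → sumChoices≡sumList (F ∘ (k ∷_))) ⟩
    sumF (λ k → sumList (map (F ∘ (k ∷_)) (allChoices m K)))
      ≡⟨ sumF≡sumList-tabulate g ⟩
    sumList (List.tabulate (λ k → sumList (map (F ∘ (k ∷_)) (allChoices m K))))
      ≡⟨ cong sumList (ListP.map-tabulate id g) ⟨
    sumList (map (λ k → sumList (map (F ∘ (k ∷_)) (allChoices m K))) (allFin K))
      ≡⟨ sumList-cartesianProduct F (allFin K) (allChoices m K) ⟨
    sumList (map F (allChoices (suc m) K)) ∎
    where
      open ≡-Reasoning
      g : Fin K → ℤ
      g k = sumList (map (F ∘ (k ∷_)) (allChoices m K))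

  ∈-allChoices : ∀ {m K} (v : Vec (Fin K) m) → v ∈ allChoices m K
  ∈-allChoices []      = here refl
  ∈-allChoices (k ∷ v) = MemP.∈-cartesianProductWith⁺ _∷_ (MemP.∈-allFin k) (∈-allChoices v)

  allChoices-unique : ∀ m K → Unique (allChoices m K)
  allChoices-unique zero    K = [] AllPairs.∷ AllPairs.[]
  allChoices-unique (suc m) K =
    UniqueP.cartesianProductWith⁺ _∷_ VecP.∷-injective (UniqueP.allFin⁺ K) (allChoices-unique m K)

  sumList-ι≡length-filter : ∀ {X : Set} {P : X → Set} (P? : ∀ x → Dec (P x)) (xs : List X) →
    sumList (map (λ x → ι (P? x)) xs) ≡ + length (filter P? xs)
  sumList-ι≡length-filter P? []       = refl
  sumList-ι≡length-filter P? (x ∷ xs) with P? x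
  ... | yes _ = trans (cong (_+_ (+ 1)) (sumList-ι≡length-filter P? xs)) (sym (ℤP.pos-+ 1 _))
  ... | no _  = trans (ℤP.+-identityˡ _) (sumList-ι≡length-filter P? xs)

  sumChoices-ι≡length-filter : ∀ {m K} {P : Vec (Fin K) m → Set} (P? : ∀ v → Dec (P v)) →
    sumChoices (λ v → ι (P? v)) ≡ + length (filter P? (allChoices m K))
  sumChoices-ι≡length-filter {m} {K} P? =
    trans (sumChoices≡sumList (λ v → ι (P? v))) (sumList-ι≡length-filter P? (allChoices m K))

  countTrue : ∀ {k} → (Fin k → Bool) → ℕ
  countTrue {zero}  f = 0
  countTrue {suc k} f = (if f zero then 1 else 0) ℕ.+ countTrue (f ∘ suc)

  prodF-zero : ∀ {k} (f : Fin k → ℤ) a → f a ≡ + 0 → prodF f ≡ + 0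
  prodF-zero f zero    e = cong (_* prodF (f ∘ suc)) e
  prodF-zero f (suc a) e = trans (cong (f zero *_) (prodF-zero (f ∘ suc) a e)) (ℤP.*-zeroʳ (f zero))

  prodF-∣signs∣ : ∀ {k} (f : Fin k → ℤ) → (∀ a → IsSignEntry (f a)) → (∀ a → f a ≢ + 0) →
    prodF (λ a → + ∣ f a ∣) ≡ + 1
  prodF-∣signs∣ {zero}  f _ _ = refl
  prodF-∣signs∣ {suc k} f sign ≢0 with sign zero
  ... | inj₁ e rewrite e        = trans (ℤP.*-identityˡ _) (prodF-∣signs∣ (f ∘ suc) (sign ∘ suc) (≢0 ∘ suc))
  ... | inj₂ (inj₁ e)           = ⊥-elim (≢0 zero e)
  ... | inj₂ (inj₂ e) rewrite e = trans (ℤP.*-identityˡ _) (prodF-∣signs∣ (f ∘ suc) (sign ∘ suc) (≢0 ∘ suc))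

  prodF-signs : ∀ {k} (f : Fin k → ℤ) → (∀ a → IsSignEntry (f a)) → (∀ a → f a ≢ + 0) →
    prodF f ≡ signPow (countTrue (λ a → does (f a ℤP.≟ -[1+ 0 ])))
  prodF-signs {zero}  f _ _ = refl
  prodF-signs {suc k} f sign ≢0 with sign zero
  ... | inj₁ e rewrite e        = trans (ℤP.*-identityˡ _) (prodF-signs (f ∘ suc) (sign ∘ suc) (≢0 ∘ suc))
  ... | inj₂ (inj₁ e)           = ⊥-elim (≢0 zero e)
  ... | inj₂ (inj₂ e) rewrite e =
    trans (cong (-[1+ 0 ] *_) (prodF-signs (f ∘ suc) (sign ∘ suc) (≢0 ∘ suc)))
          (trans (ℤP.-1*i≡-i _) (sym (signPow-suc (countTrue (λ a → does (f (suc a) ℤP.≟ -[1+ 0 ]))))))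

  parity : ∀ c → (c % 2 ≡ 0) ⊎ (c % 2 ≡ 1)
  parity zero          = inj₁ refl
  parity (suc zero)    = inj₂ refl
  parity (suc (suc c)) = parity c

  signPow-even : ∀ c → c % 2 ≡ 0 → signPow c ≡ + 1
  signPow-even zero          _  = refl
  signPow-even (suc zero)    ()
  signPow-even (suc (suc c)) e  = signPow-even c e

  signPow-odd : ∀ c → c % 2 ≡ 1 → signPow c ≡ -[1+ 0 ]
  signPow-odd zero          ()
  signPow-odd (suc zero)    _ = refl
  signPow-odd (suc (suc c)) e = signPow-odd c e

  -- Splitting the halting choices that pick edges of G by the parity of their negative edges.
  weight-split : ∀ {H C E O : Set} (H? : Dec H) (C? : Dec C) (E? : Dec E) (O? : Dec O) (w : ℤ) →
    (C → w ≡ + 1) → (¬ C → w ≡ + 0) → E ⊎ O → (E → ¬ O) →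
    w * ι H? ≡ ι (H? ×-dec (C? ×-dec E?)) + ι (H? ×-dec (C? ×-dec O?))
  weight-split (no _)  _        _       _       w _   _   _         _         = ℤP.*-zeroʳ w
  weight-split (yes _) (no ¬c)  _       _       w _   ¬c⇒ _         _         rewrite ¬c⇒ ¬c = refl
  weight-split (yes _) (yes c)  (yes e) (yes o) w _   _   _         exclusive = ⊥-elim (exclusive e o)
  weight-split (yes _) (yes c)  (yes _) (no _)  w c⇒ _   _         _         rewrite c⇒ c = refl
  weight-split (yes _) (yes c)  (no _)  (yes _) w c⇒ _   _         _         rewrite c⇒ c = refl
  weight-split (yes _) (yes _)  (no ¬e) (no ¬o) w _   _   (inj₁ e)  _         = ⊥-elim (¬e e)
  weight-split (yes _) (yes _)  (no ¬e) (no ¬o) w _   _   (inj₂ o)  _         = ⊥-elim (¬o o)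

  signedWeight-split : ∀ {H C E O : Set} (H? : Dec H) (C? : Dec C) (E? : Dec E) (O? : Dec O) (w : ℤ) →
    (C → E → w ≡ + 1) → (C → O → w ≡ -[1+ 0 ]) → (¬ C → w ≡ + 0) → E ⊎ O → (E → ¬ O) →
    w * ι H? ≡ ι (H? ×-dec (C? ×-dec E?)) - ι (H? ×-dec (C? ×-dec O?))
  signedWeight-split (no _)  _       _       _       w _  _  _   _        _         = ℤP.*-zeroʳ w
  signedWeight-split (yes _) (no ¬c) _       _       w _  _  ¬c⇒ _        _         rewrite ¬c⇒ ¬c = refl
  signedWeight-split (yes _) (yes c) (yes e) (yes o) w _  _  _   _        exclusive = ⊥-elim (exclusive e o)
  signedWeight-split (yes _) (yes c) (yes e) (no _)  w e⇒ _  _   _        _         rewrite e⇒ c e = refl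
  signedWeight-split (yes _) (yes c) (no _)  (yes o) w _  o⇒ _   _        _         rewrite o⇒ c o = refl
  signedWeight-split (yes _) (yes _) (no ¬e) (no ¬o) w _  _  _   (inj₁ e) _         = ⊥-elim (¬e e)
  signedWeight-split (yes _) (yes _) (no ¬e) (no ¬o) w _  _  _   (inj₂ o) _         = ⊥-elim (¬o o)

  -- Spanning trees of a signed graph as choice vectors

  does-true : ∀ {P : Set} (P? : Dec P) → P → does P? ≡ true
  does-true (yes _) _ = refl
  does-true (no ¬p) p = ⊥-elim (¬p p)

  does-false : ∀ {P : Set} (P? : Dec P) → ¬ P → does P? ≡ false
  does-false (yes p) ¬p = ⊥-elim (¬p p)
  does-false (no _)  _  = refl

  true⇒witness : ∀ {P : Set} (P? : Dec P) → does P? ≡ true → P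
  true⇒witness (yes p) _ = p

  module SpanningTrees {m : ℕ} (i : Fin (suc m)) (A : Matrix (suc m)) (G : IsSimpleSignedGraph A) where

    open IsSimpleSignedGraph G

    _≟ₘ_ = MaybeP.≡-dec (FinP._≟_ {suc m})

    -- The vertex punchIn i a chooses the neighbour v[a] as its parent; the root i has none.
    parentOf : Vec (Fin (suc m)) m → Fin (suc m) → Maybe (Fin (suc m))
    parentOf v x with i FinP.≟ x
    ... | yes _   = nothing
    ... | no i≢x = just (lookup v (punchOut i≢x))

    parentOf-root : ∀ v → parentOf v i ≡ nothing
    parentOf-root v with i FinP.≟ i
    ... | yes _  = refl
    ... | no i≢i = ⊥-elim (i≢i refl)

    parentOf-punchIn : ∀ v a → parentOf v (punchIn i a) ≡ just (lookup v a)
    parentOf-punchIn v a with i FinP.≟ punchIn i a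
    ... | yes i≡ = ⊥-elim (FinP.punchInᵢ≢i i a (sym i≡))
    ... | no _   = cong (λ z → just (lookup v z)) (trans (FinP.punchOut-cong i refl) (FinP.punchOut-punchIn i))

    only-root-orphan : ∀ v x → parentOf v x ≡ nothing → x ≡ i
    only-root-orphan v x e with i FinP.≟ x
    ... | yes i≡x = sym i≡x

    parentOf-just : ∀ v x y → parentOf v x ≡ just y → Σ (Fin m) λ a → x ≡ punchIn i a × y ≡ lookup v a
    parentOf-just v x y e with i FinP.≟ x
    parentOf-just v x y refl | no i≢x = punchOut i≢x , sym (FinP.punchIn-punchOut i≢x) , refl

    -- How a point of the minor and the vertex it stands for move under the two maps.
    Corresponds : Maybe (Fin m) → Maybe (Fin (suc m)) → Set
    Corresponds (just c) w = w ≡ just (punchIn i c)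
    Corresponds nothing  w = (w ≡ just i) ⊎ (w ≡ nothing)

    corresponds-punchOut? : ∀ y → Corresponds (punchOut? i y) (just y)
    corresponds-punchOut? y with i FinP.≟ y
    ... | yes refl = inj₁ refl
    ... | no i≢y  = cong just (sym (FinP.punchIn-punchOut i≢y))

    corresponds-step : ∀ v x w → Corresponds x w → Corresponds (x >>= choiceMap i v) (w >>= parentOf v)
    corresponds-step v (just c) w e rewrite e | parentOf-punchIn v c = corresponds-punchOut? (lookup v c)
    corresponds-step v nothing  w (inj₁ e) rewrite e = inj₂ (parentOf-root v)
    corresponds-step v nothing  w (inj₂ e) rewrite e = inj₂ refl

    corresponds-iterate : ∀ v k a → Corresponds (iterate (choiceMap i v) k a) (iterate (parentOf v) k (punchIn i a))
    corresponds-iterate v zero    a = refl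
    corresponds-iterate v (suc k) a = corresponds-step v _ _ (corresponds-iterate v k a)

    halting-parentOf : ∀ v → HaltingWithin (choiceMap i v) → Halting (parentOf v)
    halting-parentOf v halts x with i FinP.≟ x
    ... | yes refl = 1 , parentOf-root v
    ... | no i≢x   = suc m , subst (λ z → iterate (parentOf v) (suc m) z ≡ nothing) (FinP.punchIn-punchOut i≢x)
                               (exit (corresponds-iterate v m (punchOut i≢x)))
      where
        exit : Corresponds (iterate (choiceMap i v) m (punchOut i≢x)) (iterate (parentOf v) m (punchIn i (punchOut i≢x))) →
               (iterate (parentOf v) m (punchIn i (punchOut i≢x)) >>= parentOf v) ≡ nothing
        exit c rewrite halts (punchOut i≢x) with c
        ... | inj₁ e rewrite e = parentOf-root v
        ... | inj₂ e rewrite e = refl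

    haltingWithin-choiceMap : ∀ v → Halting (parentOf v) → HaltingWithin (choiceMap i v)
    haltingWithin-choiceMap v halts = halting⇒haltingWithin (choiceMap i v) λ a →
      let (k , ek) = halts (punchIn i a) in k , leaves (iterate (choiceMap i v) k a) (corresponds-iterate v k a) ek
      where
        leaves : ∀ x {w} → Corresponds x w → w ≡ nothing → x ≡ nothing
        leaves nothing  _ _ = refl
        leaves (just c) c≡ e with trans (sym c≡) e
        ... | ()

    edge? : Vec (Fin (suc m)) m → Fin (suc m) → Fin (suc m) → Bool
    edge? v x y = does (parentOf v x ≟ₘ just y) ∨ does (parentOf v y ≟ₘ just x)

    treeOf : Vec (Fin (suc m)) m → EdgeSet (suc m)
    treeOf v = tabulate (λ x → tabulate (λ y → edge? v x y))

    treeOf-lookup : ∀ v x y → (treeOf v ∋ₑ x , y) ≡ edge? v x y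
    treeOf-lookup v x y = trans (cong (λ row → lookup row y) (VecP.lookup∘tabulate (λ x → tabulate (λ y → edge? v x y)) x))
                                (VecP.lookup∘tabulate (λ y → edge? v x y) y)

    edge?⇒parentEdge : ∀ v x y → edge? v x y ≡ true → ParentEdge′ (parentOf v) x y
    edge?⇒parentEdge v x y e with parentOf v x ≟ₘ just y | parentOf v y ≟ₘ just x
    ... | yes up | _      = inj₁ up
    ... | no _   | yes up = inj₂ up

    parentEdge⇒edge? : ∀ v x y → ParentEdge′ (parentOf v) x y → edge? v x y ≡ true
    parentEdge⇒edge? v x y (inj₁ up) rewrite does-true (parentOf v x ≟ₘ just y) up = refl
    parentEdge⇒edge? v x y (inj₂ up) rewrite does-true (parentOf v y ≟ₘ just x) up = BoolP.∨-zeroʳ _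

    inTree⇔parentEdge : ∀ v x y →
      (InT (treeOf v) x y → ParentEdge′ (parentOf v) x y) × (ParentEdge′ (parentOf v) x y → InT (treeOf v) x y)
    inTree⇔parentEdge v x y = (λ e → edge?⇒parentEdge v x y (trans (sym (treeOf-lookup v x y)) e))
                            , (λ e → trans (treeOf-lookup v x y) (parentEdge⇒edge? v x y e))

    ChoosesEdges : Vec (Fin (suc m)) m → Set
    ChoosesEdges v = ∀ a → A (punchIn i a) (lookup v a) ≢ + 0

    treeOf-spanning : ∀ v → HaltingWithin (choiceMap i v) → ChoosesEdges v → IsSpanningTree A (treeOf v)
    treeOf-spanning v halts edges = record
      { symm      = λ x y → trans (treeOf-lookup v x y)
                      (trans (BoolP.∨-comm (does (parentOf v x ≟ₘ just y)) (does (parentOf v y ≟ₘ just x))) (sym (treeOf-lookup v y x)))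
      ; noLoop    = λ x → trans (treeOf-lookup v x x) (cong (λ b → b ∨ b) (does-false (parentOf v x ≟ₘ just x) parent-irreflexive))
      ; edgesOfG  = λ x y e → parentEdge-adjacent x y (proj₁ (inTree⇔parentEdge v x y) e)
      ; connected = λ x y → walk-++ (toRoot x) (walk-reverse (λ {x} {y} → inTree-sym {x} {y}) (toRoot y))
      ; acyclic   = parentEdges-acyclic (InT (treeOf v)) λ x y → proj₁ (inTree⇔parentEdge v x y)
      }
      where
        open RootedTree (parentOf v) i (only-root-orphan v) (halting-parentOf v halts)
        inTree-sym : ∀ {x y} → InT (treeOf v) x y → InT (treeOf v) y x
        inTree-sym {x} {y} e = proj₂ (inTree⇔parentEdge v y x) (swap (proj₁ (inTree⇔parentEdge v x y) e))
        toRoot : ∀ x → Walk (InT (treeOf v)) x i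
        toRoot = walk-to-root (InT (treeOf v)) λ {x} {y} up → proj₂ (inTree⇔parentEdge v x y) (inj₁ up)
        parent-adjacent : ∀ {x y} → parentOf v x ≡ just y → Adj A x y
        parent-adjacent {x} {y} up with parentOf-just v x y up
        ... | (a , refl , refl) = edges a
        parentEdge-adjacent : ∀ x y → ParentEdge′ (parentOf v) x y → Adj A x y
        parentEdge-adjacent x y (inj₁ up)       = parent-adjacent up
        parentEdge-adjacent x y (inj₂ down) A≡0 = parent-adjacent down (trans (symmetric y x) A≡0)

    treeOf-injective : ∀ v v′ → HaltingWithin (choiceMap i v) → treeOf v ≡ treeOf v′ → v ≡ v′
    treeOf-injective v v′ halts same = trans (sym (VecP.tabulate∘lookup v))
      (trans (VecP.tabulate-cong (λ a → sym (MaybeP.just-injective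
                (trans (sym (parentOf-punchIn v′ a)) (trans (sameParents (punchIn i a)) (parentOf-punchIn v a))))))
             (VecP.tabulate∘lookup v′))
      where
        open RootedTree (parentOf v) i (only-root-orphan v) (halting-parentOf v halts) using (parent-unique)
        sameParents : ∀ x → parentOf v′ x ≡ parentOf v x
        sameParents = parent-unique (parentOf v′) (parentOf-root v′) λ x y up →
          proj₁ (inTree⇔parentEdge v′ x y) (subst (λ T → InT T x y) same (proj₂ (inTree⇔parentEdge v x y) (inj₁ up)))

    -- Every spanning tree X is treeOf v for the choice of a neighbour one step closer to i in X.
    module FromSpanningTree (X : EdgeSet (suc m)) (X-tree : IsSpanningTree A X) where

      open IsSpanningTree X-tree

      neighbourIn? : (S : Fin (suc m) → Bool) → ∀ x → Dec (Σ (Fin (suc m)) λ y → InT X x y × S y ≡ true)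
      neighbourIn? S x = FinP.any? λ y → ((X ∋ₑ x , y) Bool.≟ true) ×-dec (S y Bool.≟ true)

      withinReach : ℕ → Fin (suc m) → Bool
      withinReach zero    x = does (x FinP.≟ i)
      withinReach (suc k) x = withinReach k x ∨ does (neighbourIn? (withinReach k) x)

      walkLength : ∀ {x y} → Walk (InT X) x y → ℕ
      walkLength here       = 0
      walkLength (step _ w) = suc (walkLength w)

      withinReach-walk : ∀ {x} (w : Walk (InT X) x i) → withinReach (walkLength w) x ≡ true
      withinReach-walk here = does-true (i FinP.≟ i) refl
      withinReach-walk {x} (step {v = y} e w)
        rewrite does-true (neighbourIn? (withinReach (walkLength w)) x) (y , e , withinReach-walk w) = BoolP.∨-zeroʳ _

      private
        firstReach : (x : Fin (suc m)) → _
        firstReach x = least (λ k → withinReach k x ≡ true) (λ k → withinReach k x Bool.≟ true)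
                             (walkLength (connected x i)) (withinReach-walk (connected x i))

      depth : Fin (suc m) → ℕ
      depth x = proj₁ (firstReach x)

      depth-reach : ∀ x → withinReach (depth x) x ≡ true
      depth-reach x = proj₁ (proj₂ (proj₂ (firstReach x)))

      depth-minimal : ∀ x k → withinReach k x ≡ true → depth x ≤ k
      depth-minimal x k r = ℕP.≮⇒≥ (λ k<d → proj₂ (proj₂ (proj₂ (firstReach x))) k k<d r)

      closerNeighbour : ∀ x k → withinReach (suc k) x ≡ true → withinReach k x ≢ true →
        Σ (Fin (suc m)) λ y → InT X x y × withinReach k y ≡ true
      closerNeighbour x k reached notYet = extract (neighbourIn? (withinReach k) x) reached
        where
          extract : (found? : Dec (Σ (Fin (suc m)) λ y → InT X x y × withinReach k y ≡ true)) →
            withinReach k x ∨ does found? ≡ true → Σ (Fin (suc m)) λ y → InT X x y × withinReach k y ≡ true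
          extract (yes found) _ = found
          extract (no _)      r = ⊥-elim (notYet (trans (sym (BoolP.∨-identityʳ (withinReach k x))) r))

      closer : ∀ x → x ≢ i → Σ (Fin (suc m)) λ y → InT X x y × depth y < depth x
      closer x x≢i = go (depth x) refl
        where
          go : ∀ k → depth x ≡ k → Σ (Fin (suc m)) λ y → InT X x y × depth y < depth x
          go zero    d≡0 = ⊥-elim (x≢i (true⇒witness (x FinP.≟ i) (subst (λ k → withinReach k x ≡ true) d≡0 (depth-reach x))))
          go (suc k) d≡k+1 =
            let (y , xy , ry) = closerNeighbour x k (subst (λ k → withinReach k x ≡ true) d≡k+1 (depth-reach x))
                                  (λ rk → ℕP.<-irrefl refl (ℕP.<-≤-trans (subst (k <_) (sym d≡k+1) ℕP.≤-refl) (depth-minimal x k rk)))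
            in y , xy , subst (depth y <_) (sym d≡k+1) (s≤s (depth-minimal y k ry))

      choice : Vec (Fin (suc m)) m
      choice = tabulate λ a → proj₁ (closer (punchIn i a) (FinP.punchInᵢ≢i i a))

      parent-closer : ∀ {x y} → parentOf choice x ≡ just y → InT X x y × depth y < depth x
      parent-closer {x} {y} up with parentOf-just choice x y up
      ... | (a , refl , refl) rewrite VecP.lookup∘tabulate (λ a → proj₁ (closer (punchIn i a) (FinP.punchInᵢ≢i i a))) a =
        proj₂ (closer (punchIn i a) (FinP.punchInᵢ≢i i a))

      halting : Halting (parentOf choice)
      halting = decreasing⇒halting (parentOf choice) depth (proj₂ ∘ parent-closer)

      open RootedTree (parentOf choice) i (only-root-orphan choice) halting using (tree-edge⇒parentEdge)

      treeOf-choice : treeOf choice ≡ X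
      treeOf-choice = trans (VecP.tabulate-cong (λ x → VecP.tabulate-cong (λ y → sameEntry x y)))
                            (trans (VecP.tabulate-cong (λ x → VecP.tabulate∘lookup (lookup X x))) (VecP.tabulate∘lookup X))
        where
          X-sym : ∀ {x y} → InT X x y → InT X y x
          X-sym {x} {y} e = trans (symm y x) e
          X-irrefl : ∀ x → ¬ InT X x x
          X-irrefl x e with trans (sym (noLoop x)) e
          ... | ()
          sameEntry : ∀ x y → edge? choice x y ≡ (X ∋ₑ x , y)
          sameEntry x y with edge? choice x y in eq | (X ∋ₑ x , y) in eqX
          ... | false | false = refl
          ... | true  | true  = refl
          ... | true  | false with edge?⇒parentEdge choice x y eq
          ...   | inj₁ up   = sym (trans (sym eqX) (proj₁ (parent-closer up)))
          ...   | inj₂ down = sym (trans (sym eqX) (X-sym {y} {x} (proj₁ (parent-closer down))))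
          sameEntry x y | false | true = trans (sym eq) (parentEdge⇒edge? choice x y
            (tree-edge⇒parentEdge (InT X) (λ {a} {b} → X-sym {a} {b}) acyclic X-irrefl (proj₁ ∘ parent-closer) x y eqX))

      choice-represents : Σ (Vec (Fin (suc m)) m) λ v → HaltingWithin (choiceMap i v) × ChoosesEdges v × treeOf v ≡ X
      choice-represents = choice , haltingWithin-choiceMap choice halting
                        , (λ a → edgesOfG _ _ (proj₁ (parent-closer (parentOf-punchIn choice a)))) , treeOf-choice

    isNegative : Fin (suc m) → Fin (suc m) → Bool
    isNegative x y = does (A x y ℤP.≟ -[1+ 0 ])

    negativeChoices : Vec (Fin (suc m)) m → ℕ
    negativeChoices v = countTrue (λ a → isNegative (punchIn i a) (lookup v a))

    sumF-indicator : ∀ {k} (f : Fin k → Bool) → sumF (λ a → indicator (f a)) ≡ + countTrue f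
    sumF-indicator {zero}  f = refl
    sumF-indicator {suc k} f with f zero
    ... | true  = trans (cong (_+_ (+ 1)) (sumF-indicator (f ∘ suc))) (sym (ℤP.pos-+ 1 _))
    ... | false = trans (ℤP.+-identityˡ _) (sumF-indicator (f ∘ suc))

    indicator-∨-∧ : ∀ a b q → (a ≡ true → b ≡ true → ⊥) → indicator ((a ∨ b) ∧ q) ≡ indicator (a ∧ q) + indicator (b ∧ q)
    indicator-∨-∧ false false q _ = refl
    indicator-∨-∧ false true  q _ = sym (ℤP.+-identityˡ _)
    indicator-∨-∧ true  false q _ = sym (ℤP.+-identityʳ _)
    indicator-∨-∧ true  true  q exclusive = ⊥-elim (exclusive refl refl)

    indicator-split : ∀ a l₁ l₂ c → (a ≡ true → (l₁ ≡ true × l₂ ≡ false) ⊎ (l₁ ≡ false × l₂ ≡ true)) →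
      indicator (a ∧ l₁ ∧ c) + indicator (a ∧ l₂ ∧ c) ≡ indicator (a ∧ c)
    indicator-split false l₁ l₂ c _ = refl
    indicator-split true  l₁ l₂ c xor with xor refl
    ... | inj₁ (refl , refl) = ℤP.+-identityʳ _
    ... | inj₂ (refl , refl) = ℤP.+-identityˡ _

    module NegativeEdges (v : Vec (Fin (suc m)) m) (halts : HaltingWithin (choiceMap i v)) where

      open RootedTree (parentOf v) i (only-root-orphan v) (halting-parentOf v halts) using (height-parent)

      up lt neg : Fin (suc m) → Fin (suc m) → Bool
      up x y = does (parentOf v x ≟ₘ just y)
      lt x y = does (x FinP.<? y)
      neg = isNegative

      neg-sym : ∀ x y → neg x y ≡ neg y x
      neg-sym x y = cong (λ z → does (z ℤP.≟ -[1+ 0 ])) (symmetric x y)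

      not-both : ∀ x y → up x y ≡ true → up y x ≡ true → ⊥
      not-both x y p q = ℕP.<-asym (height-parent (true⇒witness (parentOf v x ≟ₘ just y) p))
                                   (height-parent (true⇒witness (parentOf v y ≟ₘ just x) q))

      up-≢ : ∀ x y → up x y ≡ true → x ≢ y
      up-≢ x y p refl = ℕP.<-irrefl refl (height-parent (true⇒witness (parentOf v x ≟ₘ just x) p))

      lt-xor : ∀ x y → x ≢ y → (lt x y ≡ true × lt y x ≡ false) ⊎ (lt x y ≡ false × lt y x ≡ true)
      lt-xor x y x≢y with FinP.<-cmp x y
      ... | tri< x<y _ y≮x = inj₁ (does-true (x FinP.<? y) x<y , does-false (y FinP.<? x) y≮x)
      ... | tri≈ _ x≡y _   = ⊥-elim (x≢y x≡y)
      ... | tri> x≮y _ y<x = inj₂ (does-false (x FinP.<? y) x≮y , does-true (y FinP.<? x) y<x)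

      -- Each edge {x, y} of treeOf v is counted once, at the endpoint whose parent is the other.
      count-oriented : sumF (λ x → sumF (λ y → indicator ((treeOf v ∋ₑ x , y) ∧ lt x y ∧ neg x y)))
                     ≡ sumF (λ x → sumF (λ y → indicator (up x y ∧ neg x y)))
      count-oriented = begin
        sumF (λ x → sumF (λ y → indicator ((treeOf v ∋ₑ x , y) ∧ lt x y ∧ neg x y)))
          ≡⟨ sumF-cong (λ x → sumF-cong λ y → trans (cong (λ b → indicator (b ∧ lt x y ∧ neg x y)) (treeOf-lookup v x y))
                                                    (indicator-∨-∧ (up x y) (up y x) (lt x y ∧ neg x y) (not-both x y))) ⟩
        sumF (λ x → sumF (λ y → upward x y + downward x y))
          ≡⟨ sumF-cong (λ x → sumF-distrib-+ (upward x) (downward x)) ⟩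
        sumF (λ x → sumF (upward x) + sumF (downward x))
          ≡⟨ sumF-distrib-+ (λ x → sumF (upward x)) (λ x → sumF (downward x)) ⟩
        sumF (λ x → sumF (upward x)) + sumF (λ x → sumF (downward x))
          ≡⟨ cong (_+_ (sumF (λ x → sumF (upward x)))) (trans (sumF-comm downward) (sumF-cong λ x → sumF-cong λ y →
               cong (λ b → indicator (up x y ∧ lt y x ∧ b)) (neg-sym y x))) ⟩
        sumF (λ x → sumF (upward x)) + sumF (λ x → sumF (upward′ x))
          ≡⟨ sym (sumF-distrib-+ (λ x → sumF (upward x)) (λ x → sumF (upward′ x))) ⟩
        sumF (λ x → sumF (upward x) + sumF (upward′ x))
          ≡⟨ sumF-cong (λ x → trans (sym (sumF-distrib-+ (upward x) (upward′ x))) (sumF-cong λ y →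
               indicator-split (up x y) (lt x y) (lt y x) (neg x y) (λ p → lt-xor x y (up-≢ x y p)))) ⟩
        sumF (λ x → sumF (λ y → indicator (up x y ∧ neg x y))) ∎
        where
          open ≡-Reasoning
          upward downward upward′ : Fin (suc m) → Fin (suc m) → ℤ
          upward   x y = indicator (up x y ∧ lt x y ∧ neg x y)
          downward x y = indicator (up y x ∧ lt x y ∧ neg x y)
          upward′  x y = indicator (up x y ∧ lt y x ∧ neg x y)

      parentRow : ∀ x → sumF (λ y → indicator (up x y ∧ neg x y)) ≡ maybe′ (λ z → indicator (neg x z)) (+ 0) (parentOf v x)
      parentRow x with parentOf v x
      ... | nothing = sumF-zero (λ y → indicator (does (nothing ≟ₘ just y) ∧ neg x y)) λ y → refl
      ... | just z  = begin
        sumF (λ y → indicator (does (just z ≟ₘ just y) ∧ neg x y))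
          ≡⟨ sumF-remove (λ y → indicator (does (just z ≟ₘ just y) ∧ neg x y)) z ⟩
        indicator (does (just z ≟ₘ just z) ∧ neg x z)
          + sumF (λ y → indicator (does (just z ≟ₘ just (punchIn z y)) ∧ neg x (punchIn z y)))
          ≡⟨ cong₂ _+_ (cong (λ b → indicator (b ∧ neg x z)) (does-true (just z ≟ₘ just z) refl))
                       (sumF-zero _ λ y → cong (λ b → indicator (b ∧ neg x (punchIn z y)))
                          (does-false (just z ≟ₘ just (punchIn z y)) (λ q → FinP.punchInᵢ≢i z y (sym (MaybeP.just-injective q))))) ⟩
        indicator (neg x z) + + 0
          ≡⟨ ℤP.+-identityʳ _ ⟩
        indicator (neg x z) ∎
        where open ≡-Reasoning

      count-parents : sumF (λ x → sumF (λ y → indicator (up x y ∧ neg x y))) ≡ + negativeChoices v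
      count-parents = begin
        sumF (λ x → sumF (λ y → indicator (up x y ∧ neg x y)))
          ≡⟨ sumF-cong parentRow ⟩
        sumF (λ x → maybe′ (λ z → indicator (neg x z)) (+ 0) (parentOf v x))
          ≡⟨ sumF-remove (λ x → maybe′ (λ z → indicator (neg x z)) (+ 0) (parentOf v x)) i ⟩
        maybe′ (λ z → indicator (neg i z)) (+ 0) (parentOf v i)
          + sumF (λ a → maybe′ (λ z → indicator (neg (punchIn i a) z)) (+ 0) (parentOf v (punchIn i a)))
          ≡⟨ cong₂ _+_ (cong (maybe′ (λ z → indicator (neg i z)) (+ 0)) (parentOf-root v))
                       (sumF-cong λ a → cong (maybe′ (λ z → indicator (neg (punchIn i a) z)) (+ 0)) (parentOf-punchIn v a)) ⟩
        + 0 + sumF (λ a → indicator (neg (punchIn i a) (lookup v a)))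
          ≡⟨ trans (ℤP.+-identityˡ _) (sumF-indicator (λ a → neg (punchIn i a) (lookup v a))) ⟩
        + negativeChoices v ∎
        where open ≡-Reasoning

      negEdgeCount-treeOf : negEdgeCount A (treeOf v) ≡ negativeChoices v
      negEdgeCount-treeOf = cong ∣_∣ (trans count-oriented count-parents)

    Classified : ℕ → Vec (Fin (suc m)) m → Set
    Classified k v = HaltingWithin (choiceMap i v) × ChoosesEdges v × negativeChoices v % 2 ≡ k

    choosesEdges? : ∀ v → Dec (ChoosesEdges v)
    choosesEdges? v = FinP.all? λ a → ¬? (A (punchIn i a) (lookup v a) ℤP.≟ + 0)

    classified? : ∀ k v → Dec (Classified k v)
    classified? k v = haltingWithin? (choiceMap i v) ×-dec (choosesEdges? v ×-dec (negativeChoices v % 2 ℕ.≟ k))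

    countClassified : ℕ → ℕ
    countClassified k = length (filter (classified? k) (allChoices m (suc m)))

    unchosen-edge : ∀ v → ¬ ChoosesEdges v → Σ (Fin m) λ a → A (punchIn i a) (lookup v a) ≡ + 0
    unchosen-edge v ¬chooses =
      let (a , ¬≢0) = FinP.¬∀⟶∃¬ m _ (λ a → ¬? (A (punchIn i a) (lookup v a) ℤP.≟ + 0)) ¬chooses
      in a , decidable-stable (A (punchIn i a) (lookup v a) ℤP.≟ + 0) ¬≢0

    private
      0≢1 : 0 ≢ 1
      0≢1 ()

    absWeight-classified : ∀ v → prodF (λ a → absAdj A (punchIn i a) (lookup v a)) * ι (haltingWithin? (choiceMap i v))
                                  ≡ ι (classified? 0 v) + ι (classified? 1 v)
    absWeight-classified v =
      weight-split (haltingWithin? (choiceMap i v)) (choosesEdges? v) (negativeChoices v % 2 ℕ.≟ 0) (negativeChoices v % 2 ℕ.≟ 1) _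
        (λ chooses → prodF-∣signs∣ (λ a → A (punchIn i a) (lookup v a)) (λ a → entries _ _) chooses)
        (λ ¬chooses → let (a , A≡0) = unchosen-edge v ¬chooses in
                      prodF-zero (λ a → absAdj A (punchIn i a) (lookup v a)) a (cong (λ z → + ∣ z ∣) A≡0))
        (parity (negativeChoices v)) (λ e o → 0≢1 (trans (sym e) o))

    weight-classified : ∀ v → prodF (λ a → A (punchIn i a) (lookup v a)) * ι (haltingWithin? (choiceMap i v))
                               ≡ ι (classified? 0 v) - ι (classified? 1 v)
    weight-classified v =
      signedWeight-split (haltingWithin? (choiceMap i v)) (choosesEdges? v) (negativeChoices v % 2 ℕ.≟ 0) (negativeChoices v % 2 ℕ.≟ 1) _
        (λ chooses e → trans (signs chooses) (signPow-even (negativeChoices v) e))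
        (λ chooses o → trans (signs chooses) (signPow-odd (negativeChoices v) o))
        (λ ¬chooses → let (a , A≡0) = unchosen-edge v ¬chooses in prodF-zero (λ a → A (punchIn i a) (lookup v a)) a A≡0)
        (parity (negativeChoices v)) (λ e o → 0≢1 (trans (sym e) o))
      where
        signs : ChoosesEdges v → prodF (λ a → A (punchIn i a) (lookup v a)) ≡ signPow (negativeChoices v)
        signs = prodF-signs (λ a → A (punchIn i a) (lookup v a)) (λ a → entries _ _)

    det-lapAbs : det (principalMinor i (lapAbs A)) ≡ + countClassified 0 + + countClassified 1
    det-lapAbs = begin
      det (principalMinor i (laplacian (absAdj A)))
        ≡⟨ det-principalMinor-laplacian (absAdj A) i ⟩
      sumChoices (λ v → prodF (λ a → absAdj A (punchIn i a) (lookup v a)) * ι (haltingWithin? (choiceMap i v)))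
        ≡⟨ sumChoices-cong absWeight-classified ⟩
      sumChoices (λ v → ι (classified? 0 v) + ι (classified? 1 v))
        ≡⟨ sumChoices-distrib-+ (λ v → ι (classified? 0 v)) (λ v → ι (classified? 1 v)) ⟩
      sumChoices (λ v → ι (classified? 0 v)) + sumChoices (λ v → ι (classified? 1 v))
        ≡⟨ cong₂ _+_ (sumChoices-ι≡length-filter (classified? 0)) (sumChoices-ι≡length-filter (classified? 1)) ⟩
      + countClassified 0 + + countClassified 1 ∎
      where open ≡-Reasoning

    det-netLap : det (principalMinor i (netLap A)) ≡ + countClassified 0 - + countClassified 1
    det-netLap = begin
      det (principalMinor i (laplacian A))
        ≡⟨ det-principalMinor-laplacian A i ⟩
      sumChoices (λ v → prodF (λ a → A (punchIn i a) (lookup v a)) * ι (haltingWithin? (choiceMap i v)))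
        ≡⟨ sumChoices-cong weight-classified ⟩
      sumChoices (λ v → ι (classified? 0 v) - ι (classified? 1 v))
        ≡⟨ sumChoices-distrib-+ (λ v → ι (classified? 0 v)) (λ v → - ι (classified? 1 v)) ⟩
      sumChoices (λ v → ι (classified? 0 v)) + sumChoices (λ v → - ι (classified? 1 v))
        ≡⟨ cong (_+_ (sumChoices (λ v → ι (classified? 0 v)))) (neg-distrib-sumChoices (λ v → ι (classified? 1 v))) ⟩
      sumChoices (λ v → ι (classified? 0 v)) - sumChoices (λ v → ι (classified? 1 v))
        ≡⟨ cong₂ _-_ (sumChoices-ι≡length-filter (classified? 0)) (sumChoices-ι≡length-filter (classified? 1)) ⟩
      + countClassified 0 - + countClassified 1 ∎
      where open ≡-Reasoning

    -- treeOf is a bijection from the classified choice vectors to the corresponding spanning trees.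
    count-trees : ∀ k → HasCount (λ X → IsSpanningTree A X × negEdgeCount A X % 2 ≡ k) (countClassified k)
    count-trees k = map treeOf chosen , unique , (λ X → mk⇔ (to X) (from X)) , ListP.length-map treeOf chosen
      where
        chosen = filter (classified? k) (allChoices m (suc m))
        classified : ∀ {v} → v ∈ chosen → Classified k v
        classified v∈ = proj₂ (MemP.∈-filter⁻ (classified? k) {xs = allChoices m (suc m)} v∈)
        unique : Unique (map treeOf chosen)
        unique = Unique-map-injectiveOn treeOf chosen (UniqueP.filter⁺ (classified? k) (allChoices-unique m (suc m)))
          λ {v} {v′} v∈ _ → treeOf-injective v v′ (proj₁ (classified v∈))
        to : ∀ X → X ∈ map treeOf chosen → IsSpanningTree A X × negEdgeCount A X % 2 ≡ k
        to X X∈ with MemP.∈-map⁻ treeOf X∈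
        ... | (v , v∈ , refl) with classified v∈
        ...   | (halts , chooses , parity) =
          treeOf-spanning v halts chooses , trans (cong (_% 2) (NegativeEdges.negEdgeCount-treeOf v halts)) parity
        from : ∀ X → IsSpanningTree A X × negEdgeCount A X % 2 ≡ k → X ∈ map treeOf chosen
        from X (X-tree , parity) with FromSpanningTree.choice-represents X X-tree
        ... | (v , halts , chooses , refl) = MemP.∈-map⁺ treeOf (MemP.∈-filter⁺ (classified? k) (∈-allChoices v)
                (halts , chooses , trans (cong (_% 2) (sym (NegativeEdges.negEdgeCount-treeOf v halts))) parity))

  [p+q]+[p-q]≡2p : ∀ p q → (+ p + + q) + (+ p - + q) ≡ + (2 ℕ.* p)
  [p+q]+[p-q]≡2p p q = begin
    (+ p + + q) + (+ p - + q) ≡⟨ solve 2 (λ x y → (x :+ y) :+ (x :- y) := x :+ x) refl (+ p) (+ q) ⟩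
    + p + + p                 ≡⟨ ℤP.pos-+ p p ⟨
    + (p ℕ.+ p)               ≡⟨ cong (λ z → + (p ℕ.+ z)) (ℕP.+-identityʳ p) ⟨
    + (2 ℕ.* p)               ∎
    where open ≡-Reasoning

  [p+q]-[p-q]≡2q : ∀ p q → (+ p + + q) - (+ p - + q) ≡ + (2 ℕ.* q)
  [p+q]-[p-q]≡2q p q = begin
    (+ p + + q) - (+ p - + q) ≡⟨ solve 2 (λ x y → (x :+ y) :- (x :- y) := y :+ y) refl (+ p) (+ q) ⟩
    + q + + q                 ≡⟨ ℤP.pos-+ q q ⟨
    + (q ℕ.+ q)               ≡⟨ cong (λ z → + (q ℕ.+ z)) (ℕP.+-identityʳ q) ⟨
    + (2 ℕ.* q)               ∎
    where open ≡-Reasoning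

open import Defs
open import Data.Nat using (ℕ; suc; _≤_; _*_)
open import Data.Integer using (+_; _+_; _-_)
open import Data.Fin using (Fin)
open import Data.Product using (Σ; _×_; _,_)
open import Relation.Binary.PropositionalEquality using (_≡_; trans; cong₂)

open SignedMatrixTree using (module SpanningTrees; [p+q]+[p-q]≡2p; [p+q]-[p-q]≡2q)

mainTheorem2 : (m : ℕ) → 2 ≤ suc m
    → (A : Matrix (suc m)) → IsSimpleSignedGraph A → Connected (Adj A)
    → (i : Fin (suc m))
    → (Σ ℕ λ p → HasCount (IsPositiveTree A) p
    × (det (principalMinor i (lapAbs A)) + det (principalMinor i (netLap A)) ≡ + (2 * p)))
    × (Σ ℕ λ q → HasCount (IsNegativeTree A) q
    × (det (principalMinor i (lapAbs A)) - det (principalMinor i (netLap A)) ≡ + (2 * q)))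
mainTheorem2 m _ A G _ i =
  (p , count-trees 0 , trans (cong₂ _+_ det-lapAbs det-netLap) ([p+q]+[p-q]≡2p p q)) ,
  (q , count-trees 1 , trans (cong₂ _-_ det-lapAbs det-netLap) ([p+q]-[p-q]≡2q p q))
  where
    open SpanningTrees i A G
    p = countClassified 0
    q = countClassified 1
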